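{- For all $n\ge1$ and all $S\subseteq[2n-1]$, $$\beta_n(S)=|\{w\in\mathcal{D}_n: LS(w)=S\}|.$$ In particular, for every $k\ge0$, $\sum_{w\in\mathcal{D}_n,\ \mathrm{lnfs}(w)=k}q^{\mathrm{MAJ}_\ell(w)}=N_q(n,k)$, i.e. the bi-statistic $(\mathrm{lnfs},\mathrm{MAJ}_\ell)$ has the $q$-Narayana distribution.
   Context: $\mathcal{D}_n$ is the set of Dyck paths $w=a_1\cdots a_{2n}$ (words in $v,h$, $n$ of each, every prefix having at least as many $v$'s as $h$'s). The long non-final sequence set is $LS(w)=\{i\in[2n-1]: a_{i-1}a_ia_{i+1}=vvh\text{ or }a_{i-1}a_ia_{i+1}=hhv\}$ (with $i\ge2$ implicitly), $\mathrm{lnfs}(w)=|LS(w)|$ and $\mathrm{MAJ}_\ell(w)=\sum_{i\in LS(w)}i$. $\mathrm{des}(w)$ is the number of indices $i$ with $a_ia_{i+1}=hv$, $\mathrm{MAJ}(w)$ the sum of these $i$, and $N_q(n,k)=\sum_{w\in\mathcal{D}_n,\ \mathrm{des}(w)=k}q^{\mathrm{MAJ}(w)}$. $\beta_n$ is the flag $h$-vector of $J(\mathbf{2}\times\mathbf{n})$, the lattice of order ideals of $\{1<2\}\times\{1<\dots<n\}$, graded of rank $2n$ by cardinality: for a finite graded poset $P$ with $\hat0,\hat1$, rank function $\rho$, $\rho(\hat1)=N$, $\alpha_P(S)=|\{c\text{ a chain of }P:\rho(c)=S\}|$ for $S\subseteq[N-1]$ and $\beta_P(S)=\sum_{T\subseteq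 S}(-1)^{|S-T|}\alpha_P(T)$. -}

module Defs where

open import Data.Bool using (Bool; true; false; _∧_; _∨_; not; if_then_else_)
open import Data.Nat using (ℕ; zero; suc; _+_; _*_; _∸_; _≡ᵇ_; _≤ᵇ_; _<ᵇ_)
open import Data.Fin using (Fin; toℕ)
open import Data.Fin.Subset using (Subset)
open import Data.List using (List; []; _∷_; _++_; map; concatMap; length; filterᵇ; foldr; allFin; cartesianProduct)
open import Data.Vec as Vec using (Vec; lookup; tabulate)
open import Data.Maybe using (Maybe; just; nothing)
open import Data.Product using (_×_; _,_)
open import Data.Integer as ℤ using (ℤ)

allᵇ : {A : Set} → (A → Bool) → List A → Bool
allᵇ p = foldr (λ x b → p x ∧ b) true

allSubsets : (m : ℕ) → List (Subset m)
allSubsets zero    = Vec.[] ∷ []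
allSubsets (suc m) = concatMap (λ s → (false Vec.∷ s) ∷ (true Vec.∷ s) ∷ []) (allSubsets m)

-- elements of S ⊆ [m], read as the numbers 1..m, in increasing order
members : {m : ℕ} → Subset m → List ℕ
members {m} S = map (λ j → suc (toℕ j)) (filterᵇ (λ j → lookup S j) (allFin m))

_⊆ᵇ_ : {m : ℕ} → Subset m → Subset m → Bool
_⊆ᵇ_ {m} T S = allᵇ (λ j → not (lookup T j) ∨ lookup S j) (allFin m)

_≡Sᵇ_ : {m : ℕ} → Subset m → Subset m → Bool
T ≡Sᵇ S = (T ⊆ᵇ S) ∧ (S ⊆ᵇ T)

diffCard : {m : ℕ} → Subset m → Subset m → ℕ
diffCard {m} S T = length (filterᵇ (λ j → lookup S j ∧ not (lookup T j)) (allFin m))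

sumℕ : List ℕ → ℕ
sumℕ = foldr _+_ 0

sumℤ : List ℤ → ℤ
sumℤ = foldr ℤ._+_ (ℤ.+ 0)

sign : ℕ → ℤ
sign zero          = ℤ.+ 1
sign (suc zero)    = ℤ.- (ℤ.+ 1)
sign (suc (suc k)) = sign k

Elt : ℕ → Set
Elt n = Fin 2 × Fin n

elts : (n : ℕ) → List (Elt n)
elts n = cartesianProduct (allFin 2) (allFin n)

leP : {n : ℕ} → Elt n → Elt n → Bool
leP (r , j) (r' , j') = (toℕ r ≤ᵇ toℕ r') ∧ (toℕ j ≤ᵇ toℕ j')

-- a subset of 2 × n: (row-1 membership , row-2 membership)
SubP : ℕ → Set
SubP n = Subset n × Subset n

memP : {n : ℕ} → SubP n → Elt n → Bool
memP (A , B) (r , j) with toℕ r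
... | zero  = lookup A j
... | suc _ = lookup B j

allSubP : (n : ℕ) → List (SubP n)
allSubP n = cartesianProduct (allSubsets n) (allSubsets n)

isIdeal : {n : ℕ} → SubP n → Bool
isIdeal {n} X = allᵇ (λ x → allᵇ (λ y → not (memP X x ∧ leP y x) ∨ memP X y) (elts n)) (elts n)

J : (n : ℕ) → List (SubP n)
J n = filterᵇ isIdeal (allSubP n)

⊆P : {n : ℕ} → SubP n → SubP n → Bool
⊆P {n} X Y = allᵇ (λ x → not (memP X x) ∨ memP Y x) (elts n)

⊂P : {n : ℕ} → SubP n → SubP n → Bool
⊂P X Y = ⊆P X Y ∧ not (⊆P Y X)

rankJ : {n : ℕ} → SubP n → ℕ
rankJ {n} X = length (filterᵇ (memP X) (elts n))

-- chains x₁ < x₂ < ... < x_r of J(2 × n) with ρ(xᵢ) = sᵢ, for a given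
-- list of ranks s₁ < ... < s_r (a chain is listed in increasing order)
chainsWithRanks : (n : ℕ) → List ℕ → List (List (SubP n))
chainsWithRanks n [] = [] ∷ []
chainsWithRanks n (s ∷ ss) =
  concatMap (λ x → map (x ∷_)
                     (filterᵇ (above x) (chainsWithRanks n ss)))
            (filterᵇ (λ x → rankJ x ≡ᵇ s) (J n))
  where
  above : SubP n → List (SubP n) → Bool
  above x []      = true
  above x (y ∷ _) = ⊂P x y

alpha : (n : ℕ) → Subset (2 * n ∸ 1) → ℕ
alpha n S = length (chainsWithRanks n (members S))

beta : (n : ℕ) → Subset (2 * n ∸ 1) → ℤ
beta n S = sumℤ (map (λ T → sign (diffCard S T) ℤ.* ℤ.+ (alpha n T))
                     (filterᵇ (λ T → T ⊆ᵇ S) (allSubsets (2 * n ∸ 1))))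

data Step : Set where
  v h : Step

allWords : ℕ → List (List Step)
allWords zero    = [] ∷ []
allWords (suc m) = concatMap (λ w → (v ∷ w) ∷ (h ∷ w) ∷ []) (allWords m)

-- height-k suffix check: every prefix has #v ≥ #h, and total #v = #h
dyckFrom : ℕ → List Step → Bool
dyckFrom k       []      = k ≡ᵇ 0
dyckFrom k       (v ∷ w) = dyckFrom (suc k) w
dyckFrom zero    (h ∷ w) = false
dyckFrom (suc k) (h ∷ w) = dyckFrom k w

Dyck : ℕ → List (List Step)
Dyck n = filterᵇ (dyckFrom 0) (allWords (2 * n))

-- a_i (1-based); nothing if out of range
letter : List Step → ℕ → Maybe Step
letter []      _             = nothing
letter (x ∷ w) zero          = nothing
letter (x ∷ w) (suc zero)    = just x
letter (x ∷ w) (suc (suc i)) = letter w (suc i)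

isLS : Maybe Step → Maybe Step → Maybe Step → Bool
isLS (just v) (just v) (just h) = true
isLS (just h) (just h) (just v) = true
isLS _ _ _ = false

inLS : List Step → ℕ → Bool
inLS w zero          = false
inLS w (suc zero)    = false
inLS w (suc (suc j)) = isLS (letter w (suc j)) (letter w (suc (suc j))) (letter w (suc (suc (suc j))))

isHV : Maybe Step → Maybe Step → Bool
isHV (just h) (just v) = true
isHV _ _ = false

inDes : List Step → ℕ → Bool
inDes w i = isHV (letter w i) (letter w (suc i))

-- LS(w) as a subset of [2n-1]  (index j : Fin (2n-1) stands for i = j+1)
LS : (n : ℕ) → List Step → Subset (2 * n ∸ 1)
LS n w = tabulate (λ j → inLS w (suc (toℕ j)))

positions : ℕ → List ℕ
positions n = map (λ j → suc (toℕ j)) (allFin (2 * n ∸ 1))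

lnfs : ℕ → List Step → ℕ
lnfs n w = length (filterᵇ (inLS w) (positions n))

MAJℓ : ℕ → List Step → ℕ
MAJℓ n w = sumℕ (filterᵇ (inLS w) (positions n))

des : ℕ → List Step → ℕ
des n w = length (filterᵇ (inDes w) (positions n))

MAJ : ℕ → List Step → ℕ
MAJ n w = sumℕ (filterᵇ (inDes w) (positions n))

countLS : (n : ℕ) → Subset (2 * n ∸ 1) → ℕ
countLS n S = length (filterᵇ (λ w → LS n w ≡Sᵇ S) (Dyck n))

-- coefficient of q^m in N_q(n,k) = Σ_{w ∈ 𝒟ₙ, des w = k} q^{MAJ w}
Nq-coeff : (n k m : ℕ) → ℕ
Nq-coeff n k m = length (filterᵇ (λ w → (des n w ≡ᵇ k) ∧ (MAJ n w ≡ᵇ m)) (Dyck n))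

-- coefficient of q^m in Σ_{w ∈ 𝒟ₙ, lnfs w = k} q^{MAJℓ w}
LSq-coeff : (n k m : ℕ) → ℕ
LSq-coeff n k m = length (filterᵇ (λ w → (lnfs n w ≡ᵇ k) ∧ (MAJℓ n w ≡ᵇ m)) (Dyck n))

module Submission where

-- A chain of J(2 × n) is an increasing sequence of staircase points (a, b), b ≤ a ≤ n (a and b
-- being the sizes of the two rows of an order ideal), and a Dyck path is a lattice path through
-- the same staircase. If LS(w) ⊆ T, the path is determined by the points it passes at the
-- positions of T: at a position outside T two equal letters must be followed by a third, so
-- between consecutive positions of T the path alternates and then runs straight, and each point
-- of the next rank lying above the current one is reached in exactly one way. Hence
-- α_n(T) = #{w : LS(w) ⊆ T}, and Möbius inversion on the Boolean lattice turns this into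
-- β_n(S) = #{w : LS(w) = S}. The same argument works for descent sets (between positions of T the
-- path is v…vh…h), so LS and Des are equidistributed as set-valued statistics; in particular
-- (lnfs, MAJℓ) and (des, MAJ) have the same joint distribution.

open import Algebra.Bundles using (CommutativeSemiring; CommutativeMonoid)
import Algebra.Properties.CommutativeSemigroup as CommSemigroupProperties
open import Data.Bool using (Bool; true; false; _∧_; if_then_else_)
open import Data.Fin.Subset using (Subset)
open import Data.List using (List; []; _∷_; _++_; map; concatMap; filterᵇ; cartesianProduct)
open import Data.Nat using (suc)
open import Data.Product using (_×_; _,_)
open import Data.Vec using (_∷_)
open import Defs using (allSubsets)

module FiniteSum {c ℓ} (R : CommutativeSemiring c ℓ) where

  open CommutativeSemiring R
  open CommSemigroupProperties +-commutativeSemigroup using (interchange)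

  ∑ : ∀ {a} {A : Set a} → List A → (A → Carrier) → Carrier
  ∑ []       f = 0#
  ∑ (x ∷ xs) f = f x + ∑ xs f

  𝟙 : Bool → Carrier
  𝟙 b = if b then 1# else 0#

  module _ {a} {A : Set a} where

    ∑-cong : (xs : List A) {f g : A → Carrier} → (∀ x → f x ≈ g x) → ∑ xs f ≈ ∑ xs g
    ∑-cong []       f≈g = refl
    ∑-cong (x ∷ xs) f≈g = +-cong (f≈g x) (∑-cong xs f≈g)

    ∑-zero : (xs : List A) {f : A → Carrier} → (∀ x → f x ≈ 0#) → ∑ xs f ≈ 0#
    ∑-zero []       f≈0 = refl
    ∑-zero (x ∷ xs) f≈0 = trans (+-cong (f≈0 x) (∑-zero xs f≈0)) (+-identityˡ 0#)

    ∑-++ : (xs ys : List A) (f : A → Carrier) → ∑ (xs ++ ys) f ≈ ∑ xs f + ∑ ys f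
    ∑-++ []       ys f = sym (+-identityˡ _)
    ∑-++ (x ∷ xs) ys f = trans (+-congˡ (∑-++ xs ys f)) (sym (+-assoc _ _ _))

    ∑-+ : (xs : List A) (f g : A → Carrier) → ∑ xs (λ x → f x + g x) ≈ ∑ xs f + ∑ xs g
    ∑-+ []       f g = sym (+-identityˡ 0#)
    ∑-+ (x ∷ xs) f g = trans (+-congˡ (∑-+ xs f g)) (interchange _ _ _ _)

    ∑-*ˡ : (xs : List A) (k : Carrier) (f : A → Carrier) → ∑ xs (λ x → k * f x) ≈ k * ∑ xs f
    ∑-*ˡ []       k f = sym (zeroʳ k)
    ∑-*ˡ (x ∷ xs) k f = trans (+-congˡ (∑-*ˡ xs k f)) (sym (distribˡ k _ _))

    ∑-filter : (p : A → Bool) (xs : List A) (f : A → Carrier) →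
               ∑ (filterᵇ p xs) f ≈ ∑ xs (λ x → 𝟙 (p x) * f x)
    ∑-filter p []       f = refl
    ∑-filter p (x ∷ xs) f with p x
    ... | true  = +-cong (sym (*-identityˡ _)) (∑-filter p xs f)
    ... | false = trans (∑-filter p xs f) (sym (trans (+-congʳ (zeroˡ _)) (+-identityˡ _)))

  ∑-map : ∀ {a b} {A : Set a} {B : Set b} (g : A → B) (xs : List A) (f : B → Carrier) →
          ∑ (map g xs) f ≈ ∑ xs (λ x → f (g x))
  ∑-map g []       f = refl
  ∑-map g (x ∷ xs) f = +-congˡ (∑-map g xs f)

  module _ {a b} {A : Set a} {B : Set b} where

    ∑-concatMap : (g : A → List B) (xs : List A) (f : B → Carrier) →
                  ∑ (concatMap g xs) f ≈ ∑ xs (λ x → ∑ (g x) f)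
    ∑-concatMap g []       f = refl
    ∑-concatMap g (x ∷ xs) f = trans (∑-++ (g x) (concatMap g xs) f) (+-congˡ (∑-concatMap g xs f))

    ∑-cartesianProduct : (xs : List A) (ys : List B) (f : A × B → Carrier) →
                         ∑ (cartesianProduct xs ys) f ≈ ∑ xs (λ x → ∑ ys (λ y → f (x , y)))
    ∑-cartesianProduct []       ys f = refl
    ∑-cartesianProduct (x ∷ xs) ys f =
      trans (∑-++ (map (_,_ x) ys) _ f) (+-cong (∑-map (_,_ x) ys f) (∑-cartesianProduct xs ys f))

    ∑-comm : (xs : List A) (ys : List B) (f : A → B → Carrier) →
             ∑ xs (λ x → ∑ ys (f x)) ≈ ∑ ys (λ y → ∑ xs (λ x → f x y))
    ∑-comm []       ys f = sym (∑-zero ys (λ _ → refl))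
    ∑-comm (x ∷ xs) ys f = trans (+-congˡ (∑-comm xs ys f)) (sym (∑-+ ys (f x) _))

  𝟙-∧ : ∀ p q → 𝟙 (p ∧ q) ≈ 𝟙 p * 𝟙 q
  𝟙-∧ true  q = sym (*-identityˡ _)
  𝟙-∧ false q = sym (zeroˡ _)

  ∑-allSubsets-suc : ∀ m (F : Subset (suc m) → Carrier) →
                     ∑ (allSubsets (suc m)) F ≈ ∑ (allSubsets m) (λ S → F (false ∷ S) + F (true ∷ S))
  ∑-allSubsets-suc m F =
    trans (∑-concatMap _ (allSubsets m) F) (∑-cong (allSubsets m) (λ S → +-congˡ (+-identityʳ _)))

open import Data.Bool using (_∨_; not; _xor_; T)
open import Data.Bool.Properties using (∧-assoc; ∧-identityʳ; ∧-zeroʳ; ∨-zeroʳ; ∨-identityʳ; ∧-commutativeMonoid; T-≡)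
open import Data.Fin using (Fin; toℕ) renaming (zero to fzero; suc to fsuc)
open import Data.Integer as ℤ using (ℤ)
import Data.Integer.Properties as ℤ
open import Data.Integer.Solver renaming (module +-*-Solver to ℤ-Solver)
open import Data.List as List using (length; allFin; replicate; upTo)
open import Data.List.Properties using (map-tabulate; map-applyUpTo; length-++; length-map; length-replicate; ++-identityʳ)
open import Data.Maybe using (Maybe; just; nothing)
open import Data.Nat as ℕ using (ℕ; zero; _+_; _*_; _∸_; _≤_; _<_; _≡ᵇ_; _≤ᵇ_; _<ᵇ_; z≤n; s≤s)
import Data.Nat.Properties as ℕ
open import Data.Nat.Solver renaming (module +-*-Solver to ℕ-Solver)
open import Data.Sum using (inj₁; inj₂)
open import Data.Vec as Vec using ([]; lookup; tabulate)
open import Data.Vec.Properties using (lookup∘tabulate; length-toList)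
open import Function using (id; _∘_)
open import Function.Bundles using (Equivalence)
open import Relation.Nullary using (contradiction)
open import Relation.Binary.PropositionalEquality hiding (J)
open Defs hiding (allSubsets)

open FiniteSum ℕ.+-*-commutativeSemiring
module ℤΣ = FiniteSum ℤ.+-*-commutativeSemiring
open CommSemigroupProperties (CommutativeMonoid.commutativeSemigroup ∧-commutativeMonoid)
  using () renaming (interchange to ∧-interchange)

length-filterᵇ : ∀ {a} {A : Set a} (p : A → Bool) (xs : List A) → length (filterᵇ p xs) ≡ ∑ xs (𝟙 ∘ p)
length-filterᵇ p []       = refl
length-filterᵇ p (x ∷ xs) with p x
... | true  = cong suc (length-filterᵇ p xs)
... | false = length-filterᵇ p xs

allFin-suc : ∀ n → allFin (suc n) ≡ fzero ∷ map fsuc (allFin n)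
allFin-suc n = cong (fzero ∷_) (sym (map-tabulate id fsuc))

module _ {A : Set} where

  allᵇ-++ : (p : A → Bool) (xs ys : List A) → allᵇ p (xs ++ ys) ≡ allᵇ p xs ∧ allᵇ p ys
  allᵇ-++ p []       ys = refl
  allᵇ-++ p (x ∷ xs) ys = trans (cong (p x ∧_) (allᵇ-++ p xs ys)) (sym (∧-assoc (p x) _ _))

  allᵇ-cong : (xs : List A) {p q : A → Bool} → (∀ x → p x ≡ q x) → allᵇ p xs ≡ allᵇ q xs
  allᵇ-cong []       p≡q = refl
  allᵇ-cong (x ∷ xs) p≡q = cong₂ _∧_ (p≡q x) (allᵇ-cong xs p≡q)

  allᵇ-true : (xs : List A) {p : A → Bool} → (∀ x → p x ≡ true) → allᵇ p xs ≡ true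
  allᵇ-true []       p≡true = refl
  allᵇ-true (x ∷ xs) p≡true rewrite p≡true x = allᵇ-true xs p≡true

  allᵇ-∧ : (p q : A → Bool) (xs : List A) → allᵇ (λ x → p x ∧ q x) xs ≡ allᵇ p xs ∧ allᵇ q xs
  allᵇ-∧ p q []       = refl
  allᵇ-∧ p q (x ∷ xs) = trans (cong ((p x ∧ q x) ∧_) (allᵇ-∧ p q xs)) (∧-interchange (p x) (q x) _ _)

allᵇ-map : ∀ {A B : Set} (p : B → Bool) (f : A → B) (xs : List A) → allᵇ p (map f xs) ≡ allᵇ (p ∘ f) xs
allᵇ-map p f []       = refl
allᵇ-map p f (x ∷ xs) = cong (p (f x) ∧_) (allᵇ-map p f xs)

allᵇ-allFin-suc : ∀ {n} (p : Fin (suc n) → Bool) → allᵇ p (allFin (suc n)) ≡ p fzero ∧ allᵇ (p ∘ fsuc) (allFin n)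
allᵇ-allFin-suc {n} p = trans (cong (allᵇ p) (allFin-suc n)) (cong (p fzero ∧_) (allᵇ-map p fsuc (allFin n)))

∑-allFin-suc : ∀ {n} (f : Fin (suc n) → ℕ) → ∑ (allFin (suc n)) f ≡ f fzero + ∑ (allFin n) (f ∘ fsuc)
∑-allFin-suc {n} f = trans (cong (λ xs → ∑ xs f) (allFin-suc n)) (cong (f fzero +_) (∑-map fsuc (allFin n) f))

⊆ᵇ-∷ : ∀ {m} x y (X Y : Subset m) → ((x ∷ X) ⊆ᵇ (y ∷ Y)) ≡ (not x ∨ y) ∧ (X ⊆ᵇ Y)
⊆ᵇ-∷ x y X Y = allᵇ-allFin-suc (λ j → not (lookup (x ∷ X) j) ∨ lookup (y ∷ Y) j)

≡Sᵇ-∷ : ∀ {m} x y (X Y : Subset m) → ((x ∷ X) ≡Sᵇ (y ∷ Y)) ≡ not (x xor y) ∧ (X ≡Sᵇ Y)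
≡Sᵇ-∷ x y X Y rewrite ⊆ᵇ-∷ x y X Y | ⊆ᵇ-∷ y x Y X with x | y
... | true  | true  = refl
... | true  | false = refl
... | false | true  = ∧-zeroʳ (X ⊆ᵇ Y)
... | false | false = refl

diffCard-∷ : ∀ {m} s t (S T : Subset m) → diffCard (s ∷ S) (t ∷ T) ≡ 𝟙 (s ∧ not t) + diffCard S T
diffCard-∷ {m} s t S T =
  trans (length-filterᵇ _ (allFin (suc m)))
        (trans (∑-allFin-suc (λ j → 𝟙 (lookup (s ∷ S) j ∧ not (lookup (t ∷ T) j))))
               (cong (𝟙 (s ∧ not t) +_) (sym (length-filterᵇ _ (allFin m)))))

∑-allSubsets-select : ∀ m (V : Subset m) (G : Subset m → ℕ) → ∑ (allSubsets m) (λ S → 𝟙 (V ≡Sᵇ S) * G S) ≡ G V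
∑-allSubsets-select zero    []      G = trans (ℕ.+-identityʳ _) (ℕ.+-identityʳ _)
∑-allSubsets-select (suc m) (x ∷ V) G =
  trans (∑-allSubsets-suc m _)
        (trans (∑-cong (allSubsets m) (select-head x)) (∑-allSubsets-select m V (λ S → G (x ∷ S))))
  where
  select-head : ∀ x S → 𝟙 ((x ∷ V) ≡Sᵇ (false ∷ S)) * G (false ∷ S) + 𝟙 ((x ∷ V) ≡Sᵇ (true ∷ S)) * G (true ∷ S)
                      ≡ 𝟙 (V ≡Sᵇ S) * G (x ∷ S)
  select-head true  S rewrite ≡Sᵇ-∷ true false V S | ≡Sᵇ-∷ true true V S = refl
  select-head false S rewrite ≡Sᵇ-∷ false false V S | ≡Sᵇ-∷ false true V S = ℕ.+-identityʳ _

-- Möbius inversion on the Boolean lattice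

sign-suc : ∀ n → sign (suc n) ≡ ℤ.- sign n
sign-suc zero          = refl
sign-suc (suc zero)    = refl
sign-suc (suc (suc n)) = sign-suc n

sign-+ : ∀ m n → sign (m + n) ≡ sign m ℤ.* sign n
sign-+ zero          n = sym (ℤ.*-identityˡ (sign n))
sign-+ (suc zero)    n = trans (sign-suc n) (sym (ℤ.-1*i≡-i (sign n)))
sign-+ (suc (suc m)) n = sign-+ m n

-- The summand of Σ_{U ⊆ T ⊆ S} (-1)^{|S - T|}, written as a sum over all T.
intervalTerm : ∀ {m} → Subset m → Subset m → Subset m → ℤ
intervalTerm U S T = ℤΣ.𝟙 (T ⊆ᵇ S) ℤ.* (sign (diffCard S T) ℤ.* ℤΣ.𝟙 (U ⊆ᵇ T))

intervalFactor : Bool → Bool → Bool → ℤ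
intervalFactor u s t = ℤΣ.𝟙 (not t ∨ s) ℤ.* (sign (𝟙 (s ∧ not t)) ℤ.* ℤΣ.𝟙 (not u ∨ t))

intervalTerm-∷ : ∀ {m} u s t (U S T : Subset m) →
  intervalTerm (u ∷ U) (s ∷ S) (t ∷ T) ≡ intervalFactor u s t ℤ.* intervalTerm U S T
intervalTerm-∷ u s t U S T
  rewrite ⊆ᵇ-∷ u t U T | ⊆ᵇ-∷ t s T S | diffCard-∷ s t S T
        | ℤΣ.𝟙-∧ (not u ∨ t) (U ⊆ᵇ T) | ℤΣ.𝟙-∧ (not t ∨ s) (T ⊆ᵇ S) | sign-+ (𝟙 (s ∧ not t)) (diffCard S T)
  = regroup (ℤΣ.𝟙 (not t ∨ s)) (sign (𝟙 (s ∧ not t))) (ℤΣ.𝟙 (not u ∨ t))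
            (ℤΣ.𝟙 (T ⊆ᵇ S)) (sign (diffCard S T)) (ℤΣ.𝟙 (U ⊆ᵇ T))
  where
  open ℤ-Solver
  regroup : ∀ a b c a′ b′ c′ → (a ℤ.* a′) ℤ.* ((b ℤ.* b′) ℤ.* (c ℤ.* c′)) ≡ (a ℤ.* (b ℤ.* c)) ℤ.* (a′ ℤ.* (b′ ℤ.* c′))
  regroup = solve 6 (λ a b c a′ b′ c′ → (a :* a′) :* ((b :* b′) :* (c :* c′)) := (a :* (b :* c)) :* (a′ :* (b′ :* c′))) refl

intervalFactor-sum : ∀ u s → intervalFactor u s false ℤ.+ intervalFactor u s true ≡ ℤΣ.𝟙 (not (u xor s))
intervalFactor-sum true  true  = refl
intervalFactor-sum true  false = refl
intervalFactor-sum false true  = refl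
intervalFactor-sum false false = refl

∑-intervalTerm : ∀ m (U S : Subset m) → ℤΣ.∑ (allSubsets m) (intervalTerm U S) ≡ ℤΣ.𝟙 (U ≡Sᵇ S)
∑-intervalTerm zero    []      []      = refl
∑-intervalTerm (suc m) (u ∷ U) (s ∷ S) = begin
  ℤΣ.∑ (allSubsets (suc m)) (intervalTerm (u ∷ U) (s ∷ S))
    ≡⟨ ℤΣ.∑-allSubsets-suc m _ ⟩
  ℤΣ.∑ (allSubsets m) (λ T → intervalTerm (u ∷ U) (s ∷ S) (false ∷ T) ℤ.+ intervalTerm (u ∷ U) (s ∷ S) (true ∷ T))
    ≡⟨ ℤΣ.∑-cong (allSubsets m) split-head ⟩
  ℤΣ.∑ (allSubsets m) (λ T → ℤΣ.𝟙 (not (u xor s)) ℤ.* intervalTerm U S T)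
    ≡⟨ ℤΣ.∑-*ˡ (allSubsets m) (ℤΣ.𝟙 (not (u xor s))) (intervalTerm U S) ⟩
  ℤΣ.𝟙 (not (u xor s)) ℤ.* ℤΣ.∑ (allSubsets m) (intervalTerm U S)
    ≡⟨ cong (ℤΣ.𝟙 (not (u xor s)) ℤ.*_) (∑-intervalTerm m U S) ⟩
  ℤΣ.𝟙 (not (u xor s)) ℤ.* ℤΣ.𝟙 (U ≡Sᵇ S)
    ≡⟨ sym (ℤΣ.𝟙-∧ (not (u xor s)) (U ≡Sᵇ S)) ⟩
  ℤΣ.𝟙 (not (u xor s) ∧ (U ≡Sᵇ S))
    ≡⟨ cong ℤΣ.𝟙 (sym (≡Sᵇ-∷ u s U S)) ⟩
  ℤΣ.𝟙 ((u ∷ U) ≡Sᵇ (s ∷ S)) ∎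
  where
  open ≡-Reasoning
  split-head : ∀ T → intervalTerm (u ∷ U) (s ∷ S) (false ∷ T) ℤ.+ intervalTerm (u ∷ U) (s ∷ S) (true ∷ T)
                   ≡ ℤΣ.𝟙 (not (u xor s)) ℤ.* intervalTerm U S T
  split-head T = begin
    _ ≡⟨ cong₂ ℤ._+_ (intervalTerm-∷ u s false U S T) (intervalTerm-∷ u s true U S T) ⟩
    _ ≡⟨ sym (ℤ.*-distribʳ-+ (intervalTerm U S T) (intervalFactor u s false) _) ⟩
    _ ≡⟨ cong (ℤ._* intervalTerm U S T) (intervalFactor-sum u s) ⟩
    _ ∎

sumℤ-map : ∀ {A : Set} (f : A → ℤ) (xs : List A) → sumℤ (map f xs) ≡ ℤΣ.∑ xs f
sumℤ-map f []       = refl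
sumℤ-map f (x ∷ xs) = cong (ℤ._+_ (f x)) (sumℤ-map f xs)

pos-𝟙 : ∀ b → ℤ.+ 𝟙 b ≡ ℤΣ.𝟙 b
pos-𝟙 true  = refl
pos-𝟙 false = refl

pos-∑ : ∀ {A : Set} (xs : List A) (f : A → ℕ) → ℤ.+ ∑ xs f ≡ ℤΣ.∑ xs (ℤ.+_ ∘ f)
pos-∑ []       f = refl
pos-∑ (x ∷ xs) f = trans (ℤ.pos-+ (f x) (∑ xs f)) (cong (ℤ._+_ (ℤ.+ f x)) (pos-∑ xs f))

beta-inversion : ∀ n {A : Set} (ws : List A) (V : A → Subset (2 * n ∸ 1)) →
  (∀ T → alpha n T ≡ ∑ ws (λ w → 𝟙 (V w ⊆ᵇ T))) →
  ∀ S → beta n S ≡ ℤ.+ ∑ ws (λ w → 𝟙 (V w ≡Sᵇ S))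
beta-inversion n ws V alpha≡ S = begin
  beta n S
    ≡⟨ sumℤ-map _ (filterᵇ (_⊆ᵇ S) (allSubsets M)) ⟩
  ℤΣ.∑ (filterᵇ (_⊆ᵇ S) (allSubsets M)) (λ T → sign (diffCard S T) ℤ.* ℤ.+ alpha n T)
    ≡⟨ ℤΣ.∑-filter (_⊆ᵇ S) (allSubsets M) _ ⟩
  ℤΣ.∑ (allSubsets M) (λ T → ℤΣ.𝟙 (T ⊆ᵇ S) ℤ.* (sign (diffCard S T) ℤ.* ℤ.+ alpha n T))
    ≡⟨ ℤΣ.∑-cong (allSubsets M) expand ⟩
  ℤΣ.∑ (allSubsets M) (λ T → ℤΣ.∑ ws (λ w → intervalTerm (V w) S T))
    ≡⟨ ℤΣ.∑-comm (allSubsets M) ws (λ T w → intervalTerm (V w) S T) ⟩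
  ℤΣ.∑ ws (λ w → ℤΣ.∑ (allSubsets M) (intervalTerm (V w) S))
    ≡⟨ ℤΣ.∑-cong ws (λ w → trans (∑-intervalTerm M (V w) S) (sym (pos-𝟙 (V w ≡Sᵇ S)))) ⟩
  ℤΣ.∑ ws (λ w → ℤ.+ 𝟙 (V w ≡Sᵇ S))
    ≡⟨ sym (pos-∑ ws (λ w → 𝟙 (V w ≡Sᵇ S))) ⟩
  ℤ.+ ∑ ws (λ w → 𝟙 (V w ≡Sᵇ S)) ∎
  where
  open ≡-Reasoning
  M : ℕ
  M = 2 * n ∸ 1
  expand : ∀ T → ℤΣ.𝟙 (T ⊆ᵇ S) ℤ.* (sign (diffCard S T) ℤ.* ℤ.+ alpha n T)
               ≡ ℤΣ.∑ ws (λ w → intervalTerm (V w) S T)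
  expand T = begin
    ℤΣ.𝟙 (T ⊆ᵇ S) ℤ.* (sign (diffCard S T) ℤ.* ℤ.+ alpha n T)
      ≡⟨ cong (λ k → ℤΣ.𝟙 (T ⊆ᵇ S) ℤ.* (sign (diffCard S T) ℤ.* k))
              (trans (cong ℤ.+_ (alpha≡ T)) (pos-∑ ws (λ w → 𝟙 (V w ⊆ᵇ T)))) ⟩
    ℤΣ.𝟙 (T ⊆ᵇ S) ℤ.* (sign (diffCard S T) ℤ.* ℤΣ.∑ ws (λ w → ℤ.+ 𝟙 (V w ⊆ᵇ T)))
      ≡⟨ cong (λ k → ℤΣ.𝟙 (T ⊆ᵇ S) ℤ.* (sign (diffCard S T) ℤ.* k))
              (ℤΣ.∑-cong ws (λ w → pos-𝟙 (V w ⊆ᵇ T))) ⟩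
    ℤΣ.𝟙 (T ⊆ᵇ S) ℤ.* (sign (diffCard S T) ℤ.* ℤΣ.∑ ws (λ w → ℤΣ.𝟙 (V w ⊆ᵇ T)))
      ≡⟨ cong (ℤΣ.𝟙 (T ⊆ᵇ S) ℤ.*_) (sym (ℤΣ.∑-*ˡ ws (sign (diffCard S T)) _)) ⟩
    ℤΣ.𝟙 (T ⊆ᵇ S) ℤ.* ℤΣ.∑ ws (λ w → sign (diffCard S T) ℤ.* ℤΣ.𝟙 (V w ⊆ᵇ T))
      ≡⟨ sym (ℤΣ.∑-*ˡ ws (ℤΣ.𝟙 (T ⊆ᵇ S)) _) ⟩
    ℤΣ.∑ ws (λ w → intervalTerm (V w) S T) ∎

∑-fibres : ∀ {A : Set} m (ws : List A) (V : A → Subset m) (F : Subset m → Bool) →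
           ∑ ws (λ w → 𝟙 (F (V w))) ≡ ∑ (allSubsets m) (λ S → ∑ ws (λ w → 𝟙 (V w ≡Sᵇ S)) * 𝟙 (F S))
∑-fibres m ws V F =
  trans (∑-cong ws (λ w → sym (∑-allSubsets-select m (V w) (𝟙 ∘ F))))
        (trans (∑-comm ws (allSubsets m) (λ w S → 𝟙 (V w ≡Sᵇ S) * 𝟙 (F S)))
               (∑-cong (allSubsets m) (λ S → trans (∑-cong ws (λ w → ℕ.*-comm (𝟙 (V w ≡Sᵇ S)) (𝟙 (F S))))
                                                  (trans (∑-*ˡ ws (𝟙 (F S)) _) (ℕ.*-comm (𝟙 (F S)) _)))))

equidistributed-∑ : ∀ {A : Set} m (ws : List A) (V V′ : A → Subset m) →
  (∀ S → ∑ ws (λ w → 𝟙 (V w ≡Sᵇ S)) ≡ ∑ ws (λ w → 𝟙 (V′ w ≡Sᵇ S))) →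
  (F : Subset m → Bool) → ∑ ws (λ w → 𝟙 (F (V w))) ≡ ∑ ws (λ w → 𝟙 (F (V′ w)))
equidistributed-∑ m ws V V′ fibres≡ F =
  trans (∑-fibres m ws V F) (trans (∑-cong (allSubsets m) (λ S → cong (_* 𝟙 (F S)) (fibres≡ S))) (sym (∑-fibres m ws V′ F)))

-- Pattern positions of a Dyck path

-- A pattern is a predicate on the letters a_{i-1} a_i a_{i+1} around a position i.
Pattern : Set
Pattern = Maybe Step → Maybe Step → Maybe Step → Bool

record IsWindowPattern (Q : Pattern) : Set where
  field
    needs-next    : ∀ a b → Q a b nothing ≡ false
    needs-current : ∀ a c → Q a nothing c ≡ false

paddedLetter : Maybe Step → Step → List Step → ℕ → Maybe Step
paddedLetter m x w zero          = m
paddedLetter m x w (suc zero)    = just x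
paddedLetter m x w (suc (suc i)) = letter w (suc i)

paddedLetter-∷ : ∀ m x y w k → paddedLetter m x (y ∷ w) (suc k) ≡ paddedLetter (just x) y w k
paddedLetter-∷ m x y w zero          = refl
paddedLetter-∷ m x y w (suc zero)    = refl
paddedLetter-∷ m x y w (suc (suc k)) = refl

occursAt : Pattern → Maybe Step → Step → List Step → ℕ → Bool
occursAt Q m x w j = Q (paddedLetter m x w j) (paddedLetter m x w (suc j)) (paddedLetter m x w (suc (suc j)))

holdsOnlyIn : ∀ {k} → (ℕ → Bool) → Subset k → Bool
holdsOnlyIn {k} f T = allᵇ (λ j → not (f (toℕ j)) ∨ lookup T j) (allFin k)

holdsOnlyIn-∷ : ∀ {k} (f : ℕ → Bool) t (T : Subset k) →
                holdsOnlyIn f (t ∷ T) ≡ (not (f 0) ∨ t) ∧ holdsOnlyIn (f ∘ suc) T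
holdsOnlyIn-∷ f t T = allᵇ-allFin-suc (λ j → not (f (toℕ j)) ∨ lookup (t ∷ T) j)

holdsOnlyIn-cong : ∀ {k} {f g : ℕ → Bool} (T : Subset k) → (∀ j → f j ≡ g j) → holdsOnlyIn f T ≡ holdsOnlyIn g T
holdsOnlyIn-cong {k} T f≡g = allᵇ-cong (allFin k) (λ j → cong (λ b → not b ∨ lookup T j) (f≡g (toℕ j)))

holdsOnlyIn-never : ∀ {k} {f : ℕ → Bool} (T : Subset k) → (∀ j → f j ≡ false) → holdsOnlyIn f T ≡ true
holdsOnlyIn-never {k} T f≡false = allᵇ-true (allFin k) (λ j → cong (λ b → not b ∨ lookup T j) (f≡false (toℕ j)))

tabulate-⊆ᵇ : ∀ {k} (g : ℕ → Bool) (T : Subset k) → (tabulate (g ∘ suc ∘ toℕ) ⊆ᵇ T) ≡ holdsOnlyIn (g ∘ suc) T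
tabulate-⊆ᵇ {k} g T =
  allᵇ-cong (allFin k) (λ j → cong (λ b → not b ∨ lookup T j) (lookup∘tabulate (g ∘ suc ∘ toℕ) j))

occursOnlyIn : ∀ {k} → Pattern → Maybe Step → Step → List Step → Subset k → Bool
occursOnlyIn Q m x []      T       = true
occursOnlyIn Q m x (y ∷ w) []      = true
occursOnlyIn Q m x (y ∷ w) (t ∷ T) = (not (Q m (just x) (just y)) ∨ t) ∧ occursOnlyIn Q (just x) y w T

holdsOnlyIn-occursAt : ∀ {Q} → IsWindowPattern Q → ∀ {k} m x w (T : Subset k) →
                       holdsOnlyIn (occursAt Q m x w) T ≡ occursOnlyIn Q m x w T
holdsOnlyIn-occursAt {Q} window m x [] T = holdsOnlyIn-never {f = occursAt Q m x []} T λ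
  { zero    → IsWindowPattern.needs-next window _ _
  ; (suc j) → IsWindowPattern.needs-current window _ _ }
holdsOnlyIn-occursAt window m x (y ∷ w) []      = refl
holdsOnlyIn-occursAt {Q} window m x (y ∷ w) (t ∷ T) =
  trans (holdsOnlyIn-∷ (occursAt Q m x (y ∷ w)) t T)
        (cong ((not (Q m (just x) (just y)) ∨ t) ∧_)
              (trans (holdsOnlyIn-cong T shift) (holdsOnlyIn-occursAt window (just x) y w T)))
  where
  shift : ∀ j → occursAt Q m x (y ∷ w) (suc j) ≡ occursAt Q (just x) y w j
  shift j = cong₂ (λ p q → Q p q (paddedLetter m x (y ∷ w) (suc (suc (suc j)))))
                  (paddedLetter-∷ m x y w j) (paddedLetter-∷ m x y w (suc j))

⊆ᵇ-occursOnlyIn : ∀ {Q} → IsWindowPattern Q → ∀ {k} (g : ℕ → Bool) x w →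
                  (∀ j → g (suc j) ≡ occursAt Q nothing x w j) → (T : Subset k) →
                  (tabulate (g ∘ suc ∘ toℕ) ⊆ᵇ T) ≡ occursOnlyIn Q nothing x w T
⊆ᵇ-occursOnlyIn window g x w g≡ T =
  trans (tabulate-⊆ᵇ g T) (trans (holdsOnlyIn-cong T g≡) (holdsOnlyIn-occursAt window nothing x w T))

longRun-window : IsWindowPattern isLS
longRun-window = record { needs-next = needs-next ; needs-current = needs-current }
  where
  needs-next : ∀ a b → isLS a b nothing ≡ false
  needs-next nothing  b        = refl
  needs-next (just v) nothing  = refl
  needs-next (just v) (just v) = refl
  needs-next (just v) (just h) = refl
  needs-next (just h) nothing  = refl
  needs-next (just h) (just v) = refl
  needs-next (just h) (just h) = refl
  needs-current : ∀ a c → isLS a nothing c ≡ false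
  needs-current nothing  c = refl
  needs-current (just v) c = refl
  needs-current (just h) c = refl

descent : Pattern
descent _ b c = isHV b c

descent-window : IsWindowPattern descent
descent-window = record { needs-next = needs-next ; needs-current = λ _ _ → refl }
  where
  needs-next : ∀ a b → isHV b nothing ≡ false
  needs-next a nothing  = refl
  needs-next a (just v) = refl
  needs-next a (just h) = refl

inLS-occursAt : ∀ x w j → inLS (x ∷ w) (suc j) ≡ occursAt isLS nothing x w j
inLS-occursAt x w zero          = refl
inLS-occursAt x w (suc zero)    = refl
inLS-occursAt x w (suc (suc j)) = refl

inDes-occursAt : ∀ x w j → inDes (x ∷ w) (suc j) ≡ occursAt descent nothing x w j
inDes-occursAt x w zero          = refl
inDes-occursAt x w (suc zero)    = refl
inDes-occursAt x w (suc (suc j)) = refl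

-- Continuations of a path whose last two letters are m and x and which has used a v-steps and
-- b h-steps so far: each further letter is admissible, the path ends on the diagonal, and the
-- pattern occurs at a position only where the corresponding bit of T is set.
completions : Pattern → Maybe Step → Step → ℕ → ℕ → List Bool → ℕ
completions Q m x a b []      = 𝟙 (a ≡ᵇ b)
completions Q m x a b (t ∷ T) =
  𝟙 (not (Q m (just x) (just v)) ∨ t) * completions Q (just x) v (suc a) b T
  + 𝟙 (b <ᵇ a) * (𝟙 (not (Q m (just x) (just h)) ∨ t) * completions Q (just x) h a (suc b) T)

∑-allWords-suc : ∀ k (F : List Step → ℕ) → ∑ (allWords (suc k)) F ≡ ∑ (allWords k) (λ w → F (v ∷ w) + F (h ∷ w))
∑-allWords-suc k F =
  trans (∑-concatMap _ (allWords k) F) (∑-cong (allWords k) (λ w → cong (F (v ∷ w) +_) (ℕ.+-identityʳ _)))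

+-≡ᵇ-right : ∀ c b → (c + b ≡ᵇ b) ≡ (c ≡ᵇ 0)
+-≡ᵇ-right zero    zero    = refl
+-≡ᵇ-right (suc c) zero    = refl
+-≡ᵇ-right zero    (suc b) = +-≡ᵇ-right zero b
+-≡ᵇ-right (suc c) (suc b) = trans (cong (_≡ᵇ b) (ℕ.+-suc c b)) (+-≡ᵇ-right (suc c) b)

<ᵇ-suc-+ : ∀ c b → (b <ᵇ suc c + b) ≡ true
<ᵇ-suc-+ c zero    = refl
<ᵇ-suc-+ c (suc b) = trans (cong (b <ᵇ_) (ℕ.+-suc c b)) (<ᵇ-suc-+ c b)

<ᵇ-irrefl : ∀ b → (b <ᵇ b) ≡ false
<ᵇ-irrefl zero    = refl
<ᵇ-irrefl (suc b) = <ᵇ-irrefl b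

𝟙-∧-pull : ∀ d p q → 𝟙 d * 𝟙 (p ∧ q) ≡ 𝟙 p * (𝟙 d * 𝟙 q)
𝟙-∧-pull d true  q = sym (ℕ.+-identityʳ _)
𝟙-∧-pull d false q = ℕ.*-zeroʳ (𝟙 d)

-- c = a − b is the height tracked by dyckFrom.
count-completions : ∀ Q {k} m x c a b → a ≡ c + b → (T : Subset k) →
  ∑ (allWords k) (λ w → 𝟙 (dyckFrom c w) * 𝟙 (occursOnlyIn Q m x w T)) ≡ completions Q m x a b (Vec.toList T)
count-completions Q m x c a b refl [] =
  trans (ℕ.+-identityʳ _) (trans (ℕ.*-identityʳ _) (cong 𝟙 (sym (+-≡ᵇ-right c b))))
count-completions Q {suc k} m x c a b a≡ (t ∷ T) =
  trans (∑-allWords-suc k _) (trans (∑-+ (allWords k) _ _) (cong₂ _+_ up-step (down-step c a≡)))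
  where
  allowed : Step → Bool
  allowed y = not (Q m (just x) (just y)) ∨ t
  up-step : ∑ (allWords k) (λ w → 𝟙 (dyckFrom c (v ∷ w)) * 𝟙 (occursOnlyIn Q m x (v ∷ w) (t ∷ T)))
            ≡ 𝟙 (allowed v) * completions Q (just x) v (suc a) b (Vec.toList T)
  up-step =
    trans (∑-cong (allWords k) (λ w → 𝟙-∧-pull (dyckFrom (suc c) w) (allowed v) (occursOnlyIn Q (just x) v w T)))
          (trans (∑-*ˡ (allWords k) (𝟙 (allowed v)) _)
                 (cong (𝟙 (allowed v) *_) (count-completions Q (just x) v (suc c) (suc a) b (cong suc a≡) T)))
  down-step : ∀ c → a ≡ c + b →
    ∑ (allWords k) (λ w → 𝟙 (dyckFrom c (h ∷ w)) * 𝟙 (occursOnlyIn Q m x (h ∷ w) (t ∷ T)))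
    ≡ 𝟙 (b <ᵇ a) * (𝟙 (allowed h) * completions Q (just x) h a (suc b) (Vec.toList T))
  down-step zero     refl rewrite <ᵇ-irrefl b = ∑-zero (allWords k) (λ w → refl)
  down-step (suc c′) refl rewrite <ᵇ-suc-+ c′ b =
    trans (∑-cong (allWords k) (λ w → 𝟙-∧-pull (dyckFrom c′ w) (allowed h) (occursOnlyIn Q (just x) h w T)))
          (trans (∑-*ˡ (allWords k) (𝟙 (allowed h)) _)
                 (trans (cong (𝟙 (allowed h) *_)
                              (count-completions Q (just x) h c′ (suc c′ + b) (suc b) (sym (ℕ.+-suc c′ b)) T))
                        (sym (ℕ.+-identityʳ _))))

-- Counting Dyck paths segment by segment

T⇒≡true : ∀ {b} → T b → b ≡ true
T⇒≡true = Equivalence.to T-≡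

≡true⇒T : ∀ {b} → b ≡ true → T b
≡true⇒T = Equivalence.from T-≡

falses : ℕ → List Bool
falses d = replicate d false

≤ᵇ-true : ∀ {m n} → m ≤ n → (m ≤ᵇ n) ≡ true
≤ᵇ-true = T⇒≡true ∘ ℕ.≤⇒≤ᵇ

<ᵇ-true : ∀ {m n} → m < n → (m <ᵇ n) ≡ true
<ᵇ-true = ≤ᵇ-true

≤ᵇ-false : ∀ {m n} → n < m → (m ≤ᵇ n) ≡ false
≤ᵇ-false {m} {n} n<m with m ≤ᵇ n in eq
... | false = refl
... | true  = contradiction (ℕ.≤ᵇ⇒≤ m n (≡true⇒T eq)) (ℕ.<⇒≱ n<m)

-- Σ G (a + i) (b + j) over i + j = e, restricted to the points with b + j ≤ a + i.
antidiagonalSum : ℕ → ℕ → ℕ → (ℕ → ℕ → ℕ) → ℕ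
antidiagonalSum a b zero    G = 𝟙 (b ≤ᵇ a) * G a b
antidiagonalSum a b (suc e) G = 𝟙 (suc e + b ≤ᵇ a) * G a (suc e + b) + antidiagonalSum (suc a) b e G

antidiagonalSum-suc : ∀ e a b G → antidiagonalSum a b (suc e) G
                      ≡ antidiagonalSum a (suc b) e G + 𝟙 (b ≤ᵇ suc e + a) * G (suc e + a) b
antidiagonalSum-suc zero    a b G = refl
antidiagonalSum-suc (suc e) a b G = begin
  𝟙 (suc (suc e) + b ≤ᵇ a) * G a (suc (suc e) + b) + antidiagonalSum (suc a) b (suc e) G
    ≡⟨ cong (λ z → 𝟙 (z ≤ᵇ a) * G a z + antidiagonalSum (suc a) b (suc e) G) (cong suc (sym (ℕ.+-suc e b))) ⟩
  X + antidiagonalSum (suc a) b (suc e) G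
    ≡⟨ cong (X +_) (antidiagonalSum-suc e (suc a) b G) ⟩
  X + (antidiagonalSum (suc a) (suc b) e G + 𝟙 (b ≤ᵇ suc e + suc a) * G (suc e + suc a) b)
    ≡⟨ sym (ℕ.+-assoc X (antidiagonalSum (suc a) (suc b) e G) _) ⟩
  X + antidiagonalSum (suc a) (suc b) e G + 𝟙 (b ≤ᵇ suc e + suc a) * G (suc e + suc a) b
    ≡⟨ cong (λ z → X + antidiagonalSum (suc a) (suc b) e G + 𝟙 (b ≤ᵇ z) * G z b) (ℕ.+-suc (suc e) a) ⟩
  antidiagonalSum a (suc b) (suc e) G + 𝟙 (b ≤ᵇ suc (suc e) + a) * G (suc (suc e) + a) b ∎
  where
  open ≡-Reasoning
  X : ℕ
  X = 𝟙 (suc e + suc b ≤ᵇ a) * G a (suc e + suc b)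

-- x can be the last letter of a Dyck prefix with a v-steps and b h-steps.
Admissible : Step → ℕ → ℕ → Set
Admissible v a b = b < a
Admissible h a b = b ≤ a

Admissible⇒≤ : ∀ x {a b} → Admissible x a b → b ≤ a
Admissible⇒≤ v = ℕ.<⇒≤
Admissible⇒≤ h b≤a = b≤a

CompletesAs : Pattern → List Bool → ℕ → (ℕ → ℕ → ℕ) → Set
CompletesAs Q E r G = ∀ m x a b → Admissible x a b → a + b ≡ r → completions Q m x a b E ≡ G a b

-- Between an allowed position and the next one, e positions further on, the path is forced:
-- it reaches each point of the antidiagonal at distance e + 1 in exactly one way.
SegmentsForced : Pattern → Set
SegmentsForced Q = ∀ r E G → CompletesAs Q E r G → ∀ e m x a b → Admissible x a b → a + b + suc e ≡ r →
                   completions Q m x a b (true ∷ (falses e ++ E)) ≡ antidiagonalSum a b (suc e) G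

private
  +-suc-left : ∀ a b e → a + b + suc e ≡ suc a + b + e
  +-suc-left a b e = ℕ.+-suc (a + b) e

  +-suc-middle : ∀ a b e → a + b + suc e ≡ a + suc b + e
  +-suc-middle a b e = trans (ℕ.+-suc (a + b) e) (cong (_+ e) (sym (ℕ.+-suc a b)))

  +-identityʳ-rank : ∀ a b {r} → a + b + 0 ≡ r → a + b ≡ r
  +-identityʳ-rank a b = trans (sym (ℕ.+-identityʳ (a + b)))

-- An h-step from (a, b) exists only when b < a; on the diagonal the antidiagonal term vanishes too.
h-step : ∀ e a b (g : ℕ → ℕ) Y → b ≤ a → (b < a → Y ≡ 𝟙 (e + suc b ≤ᵇ a) * g (e + suc b)) →
         𝟙 (b <ᵇ a) * (1 * Y) ≡ 𝟙 (suc e + b ≤ᵇ a) * g (suc e + b)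
h-step e a b g Y b≤a Y≡ with ℕ.m≤n⇒m<n∨m≡n b≤a
... | inj₁ b<a rewrite <ᵇ-true b<a | Y≡ b<a | ℕ.+-suc e b = trans (ℕ.+-identityʳ _) (ℕ.+-identityʳ _)
... | inj₂ refl rewrite <ᵇ-irrefl b | ≤ᵇ-false {suc e + b} {b} (s≤s (ℕ.m≤n+m b e)) = refl

opposite : Step → Step
opposite v = h
opposite h = v

-- An allowed position makes the next step free, exactly as after a turn.
allowed≡after-turn : ∀ m x a b rest →
                     completions isLS m x a b (true ∷ rest) ≡ completions isLS (just (opposite x)) x a b (false ∷ rest)
allowed≡after-turn m v a b rest rewrite ∨-zeroʳ (not (isLS m (just v) (just v))) | ∨-zeroʳ (not (isLS m (just v) (just h))) = refl
allowed≡after-turn m h a b rest rewrite ∨-zeroʳ (not (isLS m (just h) (just v))) | ∨-zeroʳ (not (isLS m (just h) (just h))) = refl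

module _ {r E G} (completesAs : CompletesAs isLS E r G) where

  after-vv : ∀ e a b → b < a → a + b + e ≡ r → completions isLS (just v) v a b (falses e ++ E) ≡ G (e + a) b
  after-vv zero    a b b<a rank = completesAs (just v) v a b b<a (+-identityʳ-rank a b rank)
  after-vv (suc e) a b b<a rank =
    trans (cong₂ _+_ (ℕ.*-identityˡ _) (ℕ.*-zeroʳ (𝟙 (b <ᵇ a))))
          (trans (ℕ.+-identityʳ _)
                 (trans (after-vv e (suc a) b (ℕ.m≤n⇒m≤1+n b<a) (trans (sym (+-suc-left a b e)) rank))
                        (cong (λ z → G z b) (ℕ.+-suc e a))))

  after-hh : ∀ e a b → b ≤ a → a + b + e ≡ r →
             completions isLS (just h) h a b (falses e ++ E) ≡ 𝟙 (e + b ≤ᵇ a) * G a (e + b)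
  after-hh zero    a b b≤a rank rewrite ≤ᵇ-true b≤a =
    trans (completesAs (just h) h a b b≤a (+-identityʳ-rank a b rank)) (sym (ℕ.+-identityʳ _))
  after-hh (suc e) a b b≤a rank =
    h-step e a b (G a) _ b≤a (λ b<a → after-hh e a (suc b) b<a (trans (sym (+-suc-middle a b e)) rank))

  after-turn : ∀ e x a b → Admissible x a b → a + b + e ≡ r →
               completions isLS (just (opposite x)) x a b (falses e ++ E) ≡ antidiagonalSum a b e G
  after-turn zero v a b b<a rank rewrite ≤ᵇ-true (ℕ.<⇒≤ b<a) =
    trans (completesAs (just h) v a b b<a (+-identityʳ-rank a b rank)) (sym (ℕ.+-identityʳ _))
  after-turn zero h a b b≤a rank rewrite ≤ᵇ-true b≤a =
    trans (completesAs (just v) h a b b≤a (+-identityʳ-rank a b rank)) (sym (ℕ.+-identityʳ _))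
  after-turn (suc e) v a b b<a rank
    rewrite <ᵇ-true b<a | antidiagonalSum-suc e a b G | ≤ᵇ-true (ℕ.≤-trans (ℕ.<⇒≤ b<a) (ℕ.m≤n+m a (suc e))) =
    trans (cong₂ _+_ (trans (ℕ.*-identityˡ _) (after-vv e (suc a) b (ℕ.m≤n⇒m≤1+n b<a) (trans (sym (+-suc-left a b e)) rank)))
                     (trans (ℕ.*-identityˡ _) (trans (ℕ.*-identityˡ _)
                            (after-turn e h a (suc b) b<a (trans (sym (+-suc-middle a b e)) rank)))))
          (trans (ℕ.+-comm (G (e + suc a) b) (antidiagonalSum a (suc b) e G))
                 (cong (antidiagonalSum a (suc b) e G +_)
                       (trans (cong (λ z → G z b) (ℕ.+-suc e a)) (sym (ℕ.+-identityʳ _)))))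
  after-turn (suc e) h a b b≤a rank =
    trans (cong₂ _+_ (trans (ℕ.*-identityˡ _) (after-turn e v (suc a) b (s≤s b≤a) (trans (sym (+-suc-left a b e)) rank)))
                     (h-step e a b (G a) _ b≤a (λ b<a → after-hh e a (suc b) b<a (trans (sym (+-suc-middle a b e)) rank))))
          (ℕ.+-comm (antidiagonalSum (suc a) b e G) _)

longRun-segmentsForced : SegmentsForced isLS
longRun-segmentsForced r E G completesAs e m x a b adm rank =
  trans (allowed≡after-turn m x a b (falses e ++ E)) (after-turn completesAs (suc e) x a b adm rank)

module _ {r E G} (completesAs : CompletesAs descent E r G) where

  after-h : ∀ e m a b → b ≤ a → a + b + e ≡ r →
            completions descent m h a b (falses e ++ E) ≡ 𝟙 (e + b ≤ᵇ a) * G a (e + b)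
  after-h zero    m a b b≤a rank rewrite ≤ᵇ-true b≤a =
    trans (completesAs m h a b b≤a (+-identityʳ-rank a b rank)) (sym (ℕ.+-identityʳ _))
  after-h (suc e) m a b b≤a rank =
    h-step e a b (G a) _ b≤a (λ b<a → after-h e (just h) a (suc b) b<a (trans (sym (+-suc-middle a b e)) rank))

  after-v : ∀ e m a b → b < a → a + b + e ≡ r → completions descent m v a b (falses e ++ E) ≡ antidiagonalSum a b e G
  after-v zero    m a b b<a rank rewrite ≤ᵇ-true (ℕ.<⇒≤ b<a) =
    trans (completesAs m v a b b<a (+-identityʳ-rank a b rank)) (sym (ℕ.+-identityʳ _))
  after-v (suc e) m a b b<a rank =
    trans (cong₂ _+_ (trans (ℕ.*-identityˡ _) (after-v e (just v) (suc a) b (ℕ.m≤n⇒m≤1+n b<a) (trans (sym (+-suc-left a b e)) rank)))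
                     (h-step e a b (G a) _ (ℕ.<⇒≤ b<a) (λ b<a → after-h e (just v) a (suc b) b<a (trans (sym (+-suc-middle a b e)) rank))))
          (ℕ.+-comm (antidiagonalSum (suc a) b e G) _)

descent-segmentsForced : SegmentsForced descent
descent-segmentsForced r E G completesAs e m x a b adm rank
  rewrite ∨-zeroʳ (not (descent m (just x) (just v))) | ∨-zeroʳ (not (descent m (just x) (just h))) =
  trans (cong₂ _+_ (trans (ℕ.*-identityˡ _) (after-v completesAs e (just x) (suc a) b (s≤s b≤a) (trans (sym (+-suc-left a b e)) rank)))
                   (h-step e a b (G a) _ b≤a (λ b<a → after-h completesAs e (just x) a (suc b) b<a (trans (sym (+-suc-middle a b e)) rank))))
        (ℕ.+-comm (antidiagonalSum (suc a) b e G) _)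
  where
  b≤a : b ≤ a
  b≤a = Admissible⇒≤ x adm

-- Chains of staircase points

∑-upTo-suc : ∀ n (f : ℕ → ℕ) → ∑ (upTo (suc n)) f ≡ f 0 + ∑ (upTo n) (f ∘ suc)
∑-upTo-suc n f = cong (f 0 +_) (trans (cong (λ xs → ∑ xs f) (sym (map-applyUpTo id suc n))) (∑-map suc (upTo n) f))

∑-upTo-cong : ∀ n {f g : ℕ → ℕ} → (∀ i → i < n → f i ≡ g i) → ∑ (upTo n) f ≡ ∑ (upTo n) g
∑-upTo-cong zero    f≡g = refl
∑-upTo-cong (suc n) {f} {g} f≡g = begin
  ∑ (upTo (suc n)) f          ≡⟨ ∑-upTo-suc n f ⟩
  f 0 + ∑ (upTo n) (f ∘ suc)  ≡⟨ cong₂ _+_ (f≡g 0 (s≤s z≤n)) (∑-upTo-cong n (λ i i<n → f≡g (suc i) (s≤s i<n))) ⟩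
  g 0 + ∑ (upTo n) (g ∘ suc)  ≡⟨ sym (∑-upTo-suc n g) ⟩
  ∑ (upTo (suc n)) g          ∎
  where open ≡-Reasoning

∑-upTo-select : ∀ n c (f : ℕ → ℕ) → ∑ (upTo n) (λ y → 𝟙 (c ≡ᵇ y) * f y) ≡ 𝟙 (c <ᵇ n) * f c
∑-upTo-select zero    c       f = refl
∑-upTo-select (suc n) zero    f =
  trans (∑-upTo-suc n _) (trans (cong (1 * f 0 +_) (∑-zero (upTo n) (λ _ → refl))) (ℕ.+-identityʳ _))
∑-upTo-select (suc n) (suc c) f = trans (∑-upTo-suc n (λ y → 𝟙 (suc c ≡ᵇ y) * f y)) (∑-upTo-select n c (f ∘ suc))

<ᵇ-suc : ∀ c n → (c <ᵇ suc n) ≡ (c ≤ᵇ n)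
<ᵇ-suc zero    n = refl
<ᵇ-suc (suc c) n = refl

-- The points (a, b) with b ≤ a ≤ n; (a, b) stands for the order ideal of 2 × n with a elements
-- in the first row and b in the second.
∑staircase : ℕ → (ℕ → ℕ → ℕ) → ℕ
∑staircase n F = ∑ (upTo (suc n)) (λ a → ∑ (upTo (suc n)) (λ b → 𝟙 (b ≤ᵇ a) * F a b))

∑staircase-cong : ∀ n {F G : ℕ → ℕ → ℕ} → (∀ a b → a ≤ n → b ≤ n → F a b ≡ G a b) →
                  ∑staircase n F ≡ ∑staircase n G
∑staircase-cong n F≡G =
  ∑-upTo-cong (suc n) (λ a a≤n → ∑-upTo-cong (suc n) (λ b b≤n →
    cong (𝟙 (b ≤ᵇ a) *_) (F≡G a b (ℕ.≤-pred a≤n) (ℕ.≤-pred b≤n))))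

∑staircase-+ : ∀ n (F G : ℕ → ℕ → ℕ) → ∑staircase n (λ a b → F a b + G a b) ≡ ∑staircase n F + ∑staircase n G
∑staircase-+ n F G =
  trans (∑-cong (upTo (suc n)) (λ a → trans (∑-cong (upTo (suc n)) (λ b → ℕ.*-distribˡ-+ (𝟙 (b ≤ᵇ a)) (F a b) (G a b)))
                                             (∑-+ (upTo (suc n)) (λ b → 𝟙 (b ≤ᵇ a) * F a b) (λ b → 𝟙 (b ≤ᵇ a) * G a b))))
        (∑-+ (upTo (suc n)) (λ a → ∑ (upTo (suc n)) (λ b → 𝟙 (b ≤ᵇ a) * F a b))
                            (λ a → ∑ (upTo (suc n)) (λ b → 𝟙 (b ≤ᵇ a) * G a b)))

∑staircase-zero : ∀ n (F : ℕ → ℕ → ℕ) → (∀ a b → F a b ≡ 0) → ∑staircase n F ≡ 0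
∑staircase-zero n F F≡0 =
  ∑-zero (upTo (suc n)) (λ a → ∑-zero (upTo (suc n)) (λ b → trans (cong (𝟙 (b ≤ᵇ a) *_) (F≡0 a b)) (ℕ.*-zeroʳ (𝟙 (b ≤ᵇ a)))))

aboveAtRank : ℕ → ℕ → ℕ → (ℕ → ℕ → ℕ) → ℕ → ℕ → ℕ
aboveAtRank a b s H a′ b′ = 𝟙 (a′ + b′ ≡ᵇ s) * (𝟙 (a ≤ᵇ a′) * 𝟙 (b ≤ᵇ b′) * H a′ b′)

sameColumnAtRank : ℕ → ℕ → ℕ → (ℕ → ℕ → ℕ) → ℕ → ℕ → ℕ
sameColumnAtRank a b s H a′ b′ = 𝟙 (a′ + b′ ≡ᵇ s) * (𝟙 (a ≡ᵇ a′) * 𝟙 (b ≤ᵇ b′) * H a′ b′)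

𝟙-≤ᵇ-split : ∀ a a′ → 𝟙 (a ≤ᵇ a′) ≡ 𝟙 (a ≡ᵇ a′) + 𝟙 (suc a ≤ᵇ a′)
𝟙-≤ᵇ-split zero    zero     = refl
𝟙-≤ᵇ-split zero    (suc a′) = refl
𝟙-≤ᵇ-split (suc a) zero     = refl
𝟙-≤ᵇ-split (suc a) (suc a′) =
  trans (cong 𝟙 (<ᵇ-suc a a′)) (trans (𝟙-≤ᵇ-split a a′) (cong (𝟙 (a ≡ᵇ a′) +_) (cong 𝟙 (sym (<ᵇ-suc (suc a) a′)))))

aboveAtRank-split : ∀ a b s H a′ b′ → aboveAtRank a b s H a′ b′ ≡ sameColumnAtRank a b s H a′ b′ + aboveAtRank (suc a) b s H a′ b′
aboveAtRank-split a b s H a′ b′ rewrite 𝟙-≤ᵇ-split a a′ =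
  trans (cong (𝟙 (a′ + b′ ≡ᵇ s) *_)
              (trans (cong (_* H a′ b′) (ℕ.*-distribʳ-+ (𝟙 (b ≤ᵇ b′)) (𝟙 (a ≡ᵇ a′)) _))
                     (ℕ.*-distribʳ-+ (H a′ b′) (𝟙 (a ≡ᵇ a′) * 𝟙 (b ≤ᵇ b′)) (𝟙 (suc a ≤ᵇ a′) * 𝟙 (b ≤ᵇ b′)))))
        (ℕ.*-distribˡ-+ (𝟙 (a′ + b′ ≡ᵇ s)) _ _)

aboveAtRank-below : ∀ a b s H a′ b′ → s < a + b → aboveAtRank a b s H a′ b′ ≡ 0
aboveAtRank-below a b s H a′ b′ s<a+b with a′ + b′ ≡ᵇ s in rank | a ≤ᵇ a′ in a≤a′ | b ≤ᵇ b′ in b≤b′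
... | false | _     | _     = refl
... | true  | false | _     = refl
... | true  | true  | false = refl
... | true  | true  | true  = contradiction
  (subst (a + b ≤_) (ℕ.≡ᵇ⇒≡ _ _ (≡true⇒T rank))
         (ℕ.+-mono-≤ (ℕ.≤ᵇ⇒≤ a a′ (≡true⇒T a≤a′)) (ℕ.≤ᵇ⇒≤ b b′ (≡true⇒T b≤b′))))
  (ℕ.<⇒≱ s<a+b)

𝟙≡ᵇ-subst : ∀ c y (f : ℕ → ℕ) → 𝟙 (c ≡ᵇ y) * f y ≡ 𝟙 (c ≡ᵇ y) * f c
𝟙≡ᵇ-subst c y f with c ≡ᵇ y in c≡y
... | false = refl
... | true rewrite ℕ.≡ᵇ⇒≡ c y (≡true⇒T c≡y) = refl

+-≡ᵇ-cancelˡ : ∀ a x c → (a + x ≡ᵇ a + c) ≡ (c ≡ᵇ x)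
+-≡ᵇ-cancelˡ zero    zero    zero    = refl
+-≡ᵇ-cancelˡ zero    zero    (suc c) = refl
+-≡ᵇ-cancelˡ zero    (suc x) zero    = refl
+-≡ᵇ-cancelˡ zero    (suc x) (suc c) = +-≡ᵇ-cancelˡ zero x c
+-≡ᵇ-cancelˡ (suc a) x       c       = +-≡ᵇ-cancelˡ a x c

∑-upTo-suc-select : ∀ n c (f : ℕ → ℕ) → ∑ (upTo (suc n)) (λ y → 𝟙 (c ≡ᵇ y) * f y) ≡ 𝟙 (c ≤ᵇ n) * f c
∑-upTo-suc-select n c f =
  trans (∑-cong (upTo (suc n)) (λ y → 𝟙≡ᵇ-subst c y f))
        (trans (∑-upTo-select (suc n) c (λ _ → f c)) (cong (λ b → 𝟙 b * f c) (<ᵇ-suc c n)))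

𝟙-≤ᵇ-absorb : ∀ a c n X → 𝟙 (a ≤ᵇ n) * (𝟙 (c ≤ᵇ n) * (𝟙 (c ≤ᵇ a) * X)) ≡ 𝟙 (a ≤ᵇ n) * (𝟙 (c ≤ᵇ a) * X)
𝟙-≤ᵇ-absorb a c n X with a ≤ᵇ n in a≤n | c ≤ᵇ a in c≤a
... | false | _     = refl
... | true  | false = cong (1 *_) (ℕ.*-zeroʳ (𝟙 (c ≤ᵇ n)))
... | true  | true
  rewrite T⇒≡true (ℕ.≤⇒≤ᵇ (ℕ.≤-trans (ℕ.≤ᵇ⇒≤ c a (≡true⇒T c≤a)) (ℕ.≤ᵇ⇒≤ a n (≡true⇒T a≤n)))) =
  cong (1 *_) (ℕ.+-identityʳ _)

∑staircase-sameColumnAtRank : ∀ n a b c H →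
  ∑staircase n (sameColumnAtRank a b (a + c) H) ≡ 𝟙 (b ≤ᵇ c) * (𝟙 (c ≤ᵇ a) * (𝟙 (a ≤ᵇ n) * H a c))
∑staircase-sameColumnAtRank n a b c H = begin
  ∑staircase n (sameColumnAtRank a b (a + c) H)
    ≡⟨ ∑-cong (upTo (suc n)) (λ a′ → trans (∑-cong (upTo (suc n)) (λ b′ → pull-column (𝟙 (b′ ≤ᵇ a′)) (𝟙 (a′ + b′ ≡ᵇ a + c))
                                                                        (𝟙 (a ≡ᵇ a′)) (𝟙 (b ≤ᵇ b′)) (H a′ b′)))
                                          (∑-*ˡ (upTo (suc n)) (𝟙 (a ≡ᵇ a′)) _)) ⟩
  ∑ (upTo (suc n)) (λ a′ → 𝟙 (a ≡ᵇ a′) * column a′)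
    ≡⟨ ∑-upTo-suc-select n a column ⟩
  𝟙 (a ≤ᵇ n) * column a
    ≡⟨ cong (𝟙 (a ≤ᵇ n) *_) column-a ⟩
  𝟙 (a ≤ᵇ n) * (𝟙 (c ≤ᵇ n) * (𝟙 (c ≤ᵇ a) * (𝟙 (b ≤ᵇ c) * H a c)))
    ≡⟨ 𝟙-≤ᵇ-absorb a c n _ ⟩
  𝟙 (a ≤ᵇ n) * (𝟙 (c ≤ᵇ a) * (𝟙 (b ≤ᵇ c) * H a c))
    ≡⟨ reorder (𝟙 (a ≤ᵇ n)) (𝟙 (c ≤ᵇ a)) (𝟙 (b ≤ᵇ c)) (H a c) ⟩
  𝟙 (b ≤ᵇ c) * (𝟙 (c ≤ᵇ a) * (𝟙 (a ≤ᵇ n) * H a c)) ∎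
  where
  open ≡-Reasoning
  open ℕ-Solver
  column : ℕ → ℕ
  column a′ = ∑ (upTo (suc n)) (λ b′ → 𝟙 (b′ ≤ᵇ a′) * (𝟙 (a′ + b′ ≡ᵇ a + c) * (𝟙 (b ≤ᵇ b′) * H a′ b′)))
  pull-column : ∀ x y z w u → x * (y * (z * w * u)) ≡ z * (x * (y * (w * u)))
  pull-column = solve 5 (λ x y z w u → x :* (y :* (z :* w :* u)) := z :* (x :* (y :* (w :* u)))) refl
  reorder : ∀ x y z u → x * (y * (z * u)) ≡ z * (y * (x * u))
  reorder = solve 4 (λ x y z u → x :* (y :* (z :* u)) := z :* (y :* (x :* u))) refl
  swap : ∀ x y z u → x * (y * (z * u)) ≡ y * (x * (z * u))
  swap = solve 4 (λ x y z u → x :* (y :* (z :* u)) := y :* (x :* (z :* u))) refl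
  column-a : column a ≡ 𝟙 (c ≤ᵇ n) * (𝟙 (c ≤ᵇ a) * (𝟙 (b ≤ᵇ c) * H a c))
  column-a =
    trans (∑-cong (upTo (suc n)) (λ b′ →
             trans (cong (λ z → 𝟙 (b′ ≤ᵇ a) * (𝟙 z * (𝟙 (b ≤ᵇ b′) * H a b′))) (+-≡ᵇ-cancelˡ a b′ c))
                   (swap (𝟙 (b′ ≤ᵇ a)) (𝟙 (c ≡ᵇ b′)) (𝟙 (b ≤ᵇ b′)) (H a b′))))
          (∑-upTo-suc-select n c (λ y → 𝟙 (y ≤ᵇ a) * (𝟙 (b ≤ᵇ y) * H a y)))

≤ᵇ-refl : ∀ b → (b ≤ᵇ b) ≡ true
≤ᵇ-refl b = ≤ᵇ-true (ℕ.≤-refl {b})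

∑staircase-aboveAtRank : ∀ n e a b H →
  ∑staircase n (aboveAtRank a b (a + b + e) H) ≡ antidiagonalSum a b e (λ a′ b′ → 𝟙 (a′ ≤ᵇ n) * H a′ b′)
∑staircase-aboveAtRank n e a b H =
  trans (∑staircase-cong n (λ a′ b′ _ _ → aboveAtRank-split a b (a + b + e) H a′ b′))
        (trans (∑staircase-+ n (sameColumnAtRank a b (a + b + e) H) (aboveAtRank (suc a) b (a + b + e) H)) (by-column e))
  where
  by-column : ∀ e → ∑staircase n (sameColumnAtRank a b (a + b + e) H) + ∑staircase n (aboveAtRank (suc a) b (a + b + e) H)
                    ≡ antidiagonalSum a b e (λ a′ b′ → 𝟙 (a′ ≤ᵇ n) * H a′ b′)
  by-column zero
    rewrite ℕ.+-identityʳ (a + b) | ∑staircase-sameColumnAtRank n a b b H | ≤ᵇ-refl b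
          | ∑staircase-zero n (aboveAtRank (suc a) b (a + b) H) (λ a′ b′ → aboveAtRank-below (suc a) b (a + b) H a′ b′ ℕ.≤-refl) =
    trans (ℕ.+-identityʳ _) (ℕ.+-identityʳ _)
  by-column (suc e)
    rewrite cong (λ z → ∑staircase n (sameColumnAtRank a b z H)) (trans (ℕ.+-assoc a b (suc e)) (cong (a +_) (ℕ.+-comm b (suc e))))
          | ∑staircase-sameColumnAtRank n a b (suc e + b) H | ≤ᵇ-true (ℕ.m≤n+m b (suc e))
          | cong (λ z → ∑staircase n (aboveAtRank (suc a) b z H)) (ℕ.+-suc (a + b) e) =
    cong₂ _+_ (ℕ.+-identityʳ _) (∑staircase-aboveAtRank n e (suc a) b H)

strictlyBelow : ℕ → ℕ → ℕ → ℕ → Bool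
strictlyBelow a b a′ b′ = ((a ≤ᵇ a′) ∧ (b ≤ᵇ b′)) ∧ not ((a′ ≤ᵇ a) ∧ (b′ ≤ᵇ b))

-- Chains p₁ < p₂ < ⋯ of staircase points above (a, b) whose ranks are the positions of the set bits
-- of T, the first bit standing for rank i.
staircaseChains : ℕ → ℕ → ℕ → ℕ → List Bool → ℕ
staircaseChains n a b i []          = 1
staircaseChains n a b i (false ∷ T) = staircaseChains n a b (suc i) T
staircaseChains n a b i (true ∷ T)  =
  ∑staircase n (λ a′ b′ → 𝟙 (a′ + b′ ≡ᵇ i) * (𝟙 (strictlyBelow a b a′ b′) * staircaseChains n a′ b′ (suc i) T))

strictlyBelow-higherRank : ∀ a b s H a′ b′ → a + b < s →
  𝟙 (a′ + b′ ≡ᵇ s) * (𝟙 (strictlyBelow a b a′ b′) * H a′ b′) ≡ aboveAtRank a b s H a′ b′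
strictlyBelow-higherRank a b s H a′ b′ a+b<s with a′ + b′ ≡ᵇ s in rank | a ≤ᵇ a′ | b ≤ᵇ b′
... | false | _     | _     = refl
... | true  | false | _     = refl
... | true  | true  | false = refl
... | true  | true  | true with a′ ≤ᵇ a in a′≤a | b′ ≤ᵇ b in b′≤b
...   | false | _     = refl
...   | true  | false = refl
...   | true  | true  = contradiction
  (subst (_≤ a + b) (ℕ.≡ᵇ⇒≡ _ _ (≡true⇒T rank))
         (ℕ.+-mono-≤ (ℕ.≤ᵇ⇒≤ a′ a (≡true⇒T a′≤a)) (ℕ.≤ᵇ⇒≤ b′ b (≡true⇒T b′≤b))))
  (ℕ.<⇒≱ a+b<s)

staircaseChains-falses : ∀ n a b i d E → staircaseChains n a b i (falses d ++ E) ≡ staircaseChains n a b (d + i) E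
staircaseChains-falses n a b i zero    E = refl
staircaseChains-falses n a b i (suc d) E =
  trans (staircaseChains-falses n a b (suc i) d E) (cong (λ j → staircaseChains n a b j E) (ℕ.+-suc d i))

staircaseChains-end : ∀ n a b i d → staircaseChains n a b i (falses d) ≡ 1
staircaseChains-end n a b i zero    = refl
staircaseChains-end n a b i (suc d) = staircaseChains-end n a b (suc i) d

staircaseChains-segment : ∀ n a b d T →
  staircaseChains n a b (suc (a + b)) (falses d ++ true ∷ T)
  ≡ antidiagonalSum a b (suc d) (λ a′ b′ → 𝟙 (a′ ≤ᵇ n) * staircaseChains n a′ b′ (suc (a + b + suc d)) T)
staircaseChains-segment n a b d T = begin
  staircaseChains n a b (suc (a + b)) (falses d ++ true ∷ T)
    ≡⟨ staircaseChains-falses n a b (suc (a + b)) d (true ∷ T) ⟩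
  staircaseChains n a b (d + suc (a + b)) (true ∷ T)
    ≡⟨ cong (λ i → staircaseChains n a b i (true ∷ T)) (trans (ℕ.+-comm d (suc (a + b))) (sym (ℕ.+-suc (a + b) d))) ⟩
  staircaseChains n a b r (true ∷ T)
    ≡⟨ ∑staircase-cong n (λ a′ b′ _ _ → strictlyBelow-higherRank a b r H a′ b′ (ℕ.m<m+n (a + b) (s≤s z≤n))) ⟩
  ∑staircase n (aboveAtRank a b r H)
    ≡⟨ ∑staircase-aboveAtRank n (suc d) a b H ⟩
  antidiagonalSum a b (suc d) (λ a′ b′ → 𝟙 (a′ ≤ᵇ n) * H a′ b′) ∎
  where
  open ≡-Reasoning
  r : ℕ
  r = a + b + suc d
  H : ℕ → ℕ → ℕ
  H a′ b′ = staircaseChains n a′ b′ (suc r) T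

≡ᵇ-false : ∀ {m n} → m ≢ n → (m ≡ᵇ n) ≡ false
≡ᵇ-false {m} {n} m≢n with m ≡ᵇ n in m≡n
... | false = refl
... | true  = contradiction (ℕ.≡ᵇ⇒≡ m n (≡true⇒T m≡n)) m≢n

≡ᵇ-refl : ∀ n → (n ≡ᵇ n) ≡ true
≡ᵇ-refl n = T⇒≡true (ℕ.≡⇒≡ᵇ n n refl)

private
  shorter-up : ∀ a b l → a + b + suc l < a + a → suc a + b + l < suc a + suc a
  shorter-up a b l short = ℕ.≤-trans (subst (λ z → suc z ≤ a + a) (ℕ.+-suc (a + b) l) short)
                                     (ℕ.m≤n⇒m≤1+n (ℕ.+-monoʳ-≤ a (ℕ.n≤1+n a)))

  shorter-down : ∀ a b l → a + b + suc l < a + a → a + suc b + l < a + a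
  shorter-down a b l short = subst (_< a + a) (trans (ℕ.+-suc (a + b) l) (cong (_+ l) (sym (ℕ.+-suc a b)))) short

completions-unreachable : ∀ Q m x a b T → a + b + length T < a + a → completions Q m x a b T ≡ 0
completions-unreachable Q m x a b [] a+b<a+a
  rewrite ≡ᵇ-false {a} {b} (λ { refl → ℕ.<-irrefl refl (subst (_< a + a) (ℕ.+-identityʳ (a + a)) a+b<a+a) }) = refl
completions-unreachable Q m x a b (t ∷ T) short
  rewrite completions-unreachable Q (just x) v (suc a) b T (shorter-up a b (length T) short)
        | completions-unreachable Q (just x) h a (suc b) T (shorter-down a b (length T) short) =
  cong₂ _+_ (ℕ.*-zeroʳ (𝟙 (not (Q m (just x) (just v)) ∨ t)))
            (trans (cong (𝟙 (b <ᵇ a) *_) (ℕ.*-zeroʳ (𝟙 (not (Q m (just x) (just h)) ∨ t)))) (ℕ.*-zeroʳ (𝟙 (b <ᵇ a))))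

diagonal : ℕ → ℕ → ℕ
diagonal x y = 𝟙 (x ≡ᵇ y)

antidiagonalSum-diagonal-far : ∀ e a b → b + e < a → antidiagonalSum a b e diagonal ≡ 0
antidiagonalSum-diagonal-far zero a b b<a
  rewrite ≡ᵇ-false {a} {b} (λ a≡b → ℕ.<-irrefl (sym a≡b) (subst (_< a) (ℕ.+-identityʳ b) b<a)) = ℕ.*-zeroʳ (𝟙 (b ≤ᵇ a))
antidiagonalSum-diagonal-far (suc e) a b b+e<a
  rewrite ≡ᵇ-false {a} {suc e + b} (λ a≡ → ℕ.<-irrefl (sym a≡) (subst (_< a) (trans (ℕ.+-suc b e) (cong suc (ℕ.+-comm b e))) b+e<a)) =
  trans (cong (_+ antidiagonalSum (suc a) b e diagonal) (ℕ.*-zeroʳ (𝟙 (suc e + b ≤ᵇ a))))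
        (antidiagonalSum-diagonal-far e (suc a) b
           (s≤s (ℕ.<⇒≤ (ℕ.<-trans (ℕ.n<1+n (b + e)) (subst (_< a) (ℕ.+-suc b e) b+e<a)))))

private
  off-diagonal : ∀ n e a b → a < n → a + b + suc e ≡ n + n → a ≢ suc e + b
  off-diagonal n e a b a<n rank a≡ = ℕ.<-irrefl a+a≡n+n (ℕ.+-mono-< a<n a<n)
    where
    a+a≡n+n : a + a ≡ n + n
    a+a≡n+n = trans (cong (a +_) (trans a≡ (trans (cong suc (ℕ.+-comm e b)) (sym (ℕ.+-suc b e)))))
                    (trans (sym (ℕ.+-assoc a b (suc e))) rank)

-- The antidiagonal of rank 2n meets the diagonal of the staircase only in (n, n).
antidiagonalSum-diagonal : ∀ n e a b → b ≤ a → a ≤ n → a + b + e ≡ n + n → antidiagonalSum a b e diagonal ≡ 1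
antidiagonalSum-diagonal n zero a b b≤a a≤n rank with ℕ.m≤n⇒m<n∨m≡n b≤a
... | inj₁ b<a = contradiction rank (ℕ.<⇒≢ (ℕ.≤-trans (s≤s (ℕ.≤-reflexive (ℕ.+-identityʳ (a + b))))
                                                     (ℕ.≤-trans (ℕ.+-monoʳ-< a b<a) (ℕ.+-mono-≤ a≤n a≤n))))
... | inj₂ refl rewrite ≤ᵇ-refl b | ≡ᵇ-refl b = refl
antidiagonalSum-diagonal n (suc e) a b b≤a a≤n rank with ℕ.m≤n⇒m<n∨m≡n a≤n
... | inj₁ a<n rewrite ≡ᵇ-false {a} {suc e + b} (off-diagonal n e a b a<n rank) =
  trans (cong (_+ antidiagonalSum (suc a) b e diagonal) (ℕ.*-zeroʳ (𝟙 (suc e + b ≤ᵇ a))))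
        (antidiagonalSum-diagonal n e (suc a) b (ℕ.m≤n⇒m≤1+n b≤a) a<n (trans (sym (ℕ.+-suc (a + b) e)) rank))
... | inj₂ refl = trans (cong₂ _+_ top-corner (antidiagonalSum-diagonal-far e (suc a) b (s≤s (ℕ.<⇒≤ (ℕ.≤-reflexive b+e+1≡a)))))
                        (ℕ.+-identityʳ 1)
  where
  e+1+b≡a : suc e + b ≡ a
  e+1+b≡a = ℕ.+-cancelˡ-≡ a _ _ (trans (trans (cong (a +_) (trans (cong suc (ℕ.+-comm e b)) (sym (ℕ.+-suc b e))))
                                                (sym (ℕ.+-assoc a b (suc e)))) rank)
  b+e+1≡a : suc (b + e) ≡ a
  b+e+1≡a = trans (cong suc (ℕ.+-comm b e)) e+1+b≡a
  top-corner : 𝟙 (suc e + b ≤ᵇ a) * 𝟙 (a ≡ᵇ suc e + b) ≡ 1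
  top-corner = cong₂ (λ p q → 𝟙 p * 𝟙 q) (≤ᵇ-true (ℕ.≤-reflexive e+1+b≡a)) (T⇒≡true (ℕ.≡⇒≡ᵇ a (suc e + b) (sym e+1+b≡a)))

data Segmented : List Bool → Set where
  last    : ∀ d → Segmented (falses d)
  segment : ∀ d {T} → Segmented T → Segmented (falses d ++ true ∷ T)

segmented : ∀ T → Segmented T
segmented []          = last 0
segmented (true ∷ T)  = segment 0 (segmented T)
segmented (false ∷ T) with segmented T
... | last d      = last (suc d)
... | segment d S = segment (suc d) S

module _ {Q} (forced : SegmentsForced Q) (n : ℕ) where

  completions≡staircaseChains : ∀ {T} → Segmented T → ∀ m x a b → Admissible x a b → a ≤ n →
    a + b + suc (length T) ≡ n + n → completions Q m x a b (true ∷ T) ≡ staircaseChains n a b (suc (a + b)) T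
  completions≡staircaseChains (last d) m x a b adm a≤n rank = begin
    completions Q m x a b (true ∷ falses d)
      ≡⟨ cong (λ E → completions Q m x a b (true ∷ E)) (sym (++-identityʳ (falses d))) ⟩
    completions Q m x a b (true ∷ (falses d ++ []))
      ≡⟨ forced (a + b + suc d) [] diagonal (λ _ _ _ _ _ _ → refl) d m x a b adm refl ⟩
    antidiagonalSum a b (suc d) diagonal
      ≡⟨ antidiagonalSum-diagonal n (suc d) a b (Admissible⇒≤ x adm) a≤n
           (trans (cong (λ l → a + b + suc l) (sym (length-replicate d))) rank) ⟩
    1
      ≡⟨ sym (staircaseChains-end n a b _ d) ⟩
    staircaseChains n a b (suc (a + b)) (falses d) ∎
    where open ≡-Reasoning
  completions≡staircaseChains (segment d {T} S) m x a b adm a≤n rank =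
    trans (forced r (true ∷ T) G completesAs d m x a b adm refl) (sym (staircaseChains-segment n a b d T))
    where
    r : ℕ
    r = a + b + suc d
    G : ℕ → ℕ → ℕ
    G a′ b′ = 𝟙 (a′ ≤ᵇ n) * staircaseChains n a′ b′ (suc r) T
    rank′ : ∀ a′ b′ → a′ + b′ ≡ r → a′ + b′ + suc (length T) ≡ n + n
    rank′ a′ b′ a′+b′≡r =
      trans (cong (_+ suc (length T)) a′+b′≡r)
            (trans (ℕ.+-assoc (a + b) (suc d) (suc (length T)))
                   (trans (cong (λ l → a + b + suc l)
                                (sym (trans (length-++ (falses d)) (cong (_+ suc (length T)) (length-replicate d)))))
                          rank))
    completesAs : CompletesAs Q (true ∷ T) r G
    completesAs m′ x′ a′ b′ adm′ a′+b′≡r with a′ ≤ᵇ n in a′≤n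
    ... | true  = trans (completions≡staircaseChains S m′ x′ a′ b′ adm′ (ℕ.≤ᵇ⇒≤ a′ n (≡true⇒T a′≤n)) (rank′ a′ b′ a′+b′≡r))
                        (trans (cong (λ i → staircaseChains n a′ b′ (suc i) T) a′+b′≡r) (sym (ℕ.+-identityʳ _)))
    ... | false = completions-unreachable Q m′ x′ a′ b′ (true ∷ T)
                    (subst (_< a′ + a′) (sym (rank′ a′ b′ a′+b′≡r)) (ℕ.+-mono-< n<a′ n<a′))
      where
      n<a′ : n < a′
      n<a′ = ℕ.≰⇒> (λ a′≤n′ → contradiction (trans (sym a′≤n) (≤ᵇ-true a′≤n′)) λ ())

-- Order ideals of 2 × n

prefix : (n a : ℕ) → Subset n
prefix zero    a       = []
prefix (suc n) zero    = false ∷ prefix n zero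
prefix (suc n) (suc a) = true ∷ prefix n a

emptyᵇ : ∀ {n} → Subset n → Bool
emptyᵇ []      = true
emptyᵇ (x ∷ A) = not x ∧ emptyᵇ A

isPrefixᵇ : ∀ {n} → Subset n → Bool
isPrefixᵇ []          = true
isPrefixᵇ (true ∷ A)  = isPrefixᵇ A
isPrefixᵇ (false ∷ A) = emptyᵇ A

∑-allSubsets-empty : ∀ n (G : Subset n → ℕ) → ∑ (allSubsets n) (λ A → 𝟙 (emptyᵇ A) * G A) ≡ G (prefix n 0)
∑-allSubsets-empty zero    G = trans (ℕ.+-identityʳ _) (ℕ.+-identityʳ _)
∑-allSubsets-empty (suc n) G =
  trans (∑-allSubsets-suc n _) (trans (∑-cong (allSubsets n) (λ A → ℕ.+-identityʳ _)) (∑-allSubsets-empty n (G ∘ (false ∷_))))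

∑-allSubsets-prefix : ∀ n (G : Subset n → ℕ) → ∑ (allSubsets n) (λ A → 𝟙 (isPrefixᵇ A) * G A) ≡ ∑ (upTo (suc n)) (G ∘ prefix n)
∑-allSubsets-prefix zero    G = ℕ.+-identityʳ _
∑-allSubsets-prefix (suc n) G =
  trans (∑-allSubsets-suc n _)
        (trans (∑-+ (allSubsets n) _ _)
               (trans (cong₂ _+_ (∑-allSubsets-empty n (G ∘ (false ∷_))) (∑-allSubsets-prefix n (G ∘ (true ∷_))))
                      (sym (∑-upTo-suc (suc n) (G ∘ prefix (suc n))))))

downClosedᵇ : ∀ {n} → Subset n → Subset n → Bool
downClosedᵇ {n} P Q =
  allᵇ (λ j → allᵇ (λ j′ → not (lookup P j ∧ (toℕ j′ ≤ᵇ toℕ j)) ∨ lookup Q j′) (allFin n)) (allFin n)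

nonemptyImpliesᵇ : ∀ {n} → Subset n → Bool → Bool
nonemptyImpliesᵇ {n} P q = allᵇ (λ j → not (lookup P j) ∨ q) (allFin n)

nonemptyImpliesᵇ-true : ∀ {n} (P : Subset n) → nonemptyImpliesᵇ P true ≡ true
nonemptyImpliesᵇ-true {n} P = allᵇ-true (allFin n) (λ j → ∨-zeroʳ (not (lookup P j)))

nonemptyImpliesᵇ-false : ∀ {n} (P : Subset n) → nonemptyImpliesᵇ P false ≡ emptyᵇ P
nonemptyImpliesᵇ-false []      = refl
nonemptyImpliesᵇ-false (p ∷ P) =
  trans (allᵇ-allFin-suc (λ j → not (lookup (p ∷ P) j) ∨ false))
        (cong₂ _∧_ (∨-identityʳ (not p)) (nonemptyImpliesᵇ-false P))

downClosedᵇ-∷ : ∀ {n} p q (P Q : Subset n) →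
                downClosedᵇ (p ∷ P) (q ∷ Q) ≡ (not p ∨ q) ∧ (nonemptyImpliesᵇ P q ∧ downClosedᵇ P Q)
downClosedᵇ-∷ {n} p q P Q = begin
  downClosedᵇ (p ∷ P) (q ∷ Q)
    ≡⟨ allᵇ-allFin-suc (λ j → allᵇ (λ j′ → not (lookup (p ∷ P) j ∧ (toℕ j′ ≤ᵇ toℕ j)) ∨ lookup (q ∷ Q) j′) (allFin (suc n))) ⟩
  allᵇ (λ j′ → not (p ∧ (toℕ j′ ≤ᵇ 0)) ∨ lookup (q ∷ Q) j′) (allFin (suc n))
  ∧ allᵇ (λ k → allᵇ (λ j′ → not (lookup P k ∧ (toℕ j′ ≤ᵇ suc (toℕ k))) ∨ lookup (q ∷ Q) j′) (allFin (suc n))) (allFin n)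
    ≡⟨ cong₂ _∧_ first-row (allᵇ-cong (allFin n) later-row) ⟩
  ((not p ∨ q) ∧ true)
  ∧ allᵇ (λ k → (not (lookup P k) ∨ q) ∧ allᵇ (λ k′ → not (lookup P k ∧ (toℕ k′ ≤ᵇ toℕ k)) ∨ lookup Q k′) (allFin n)) (allFin n)
    ≡⟨ cong₂ _∧_ (∧-identityʳ _) (allᵇ-∧ _ _ (allFin n)) ⟩
  (not p ∨ q) ∧ (nonemptyImpliesᵇ P q ∧ downClosedᵇ P Q) ∎
  where
  open ≡-Reasoning
  first-row : allᵇ (λ j′ → not (p ∧ (toℕ j′ ≤ᵇ 0)) ∨ lookup (q ∷ Q) j′) (allFin (suc n)) ≡ (not p ∨ q) ∧ true
  first-row = trans (allᵇ-allFin-suc (λ j′ → not (p ∧ (toℕ j′ ≤ᵇ 0)) ∨ lookup (q ∷ Q) j′))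
                    (cong₂ _∧_ (cong (λ z → not z ∨ q) (∧-identityʳ p))
                               (allᵇ-true (allFin n) (λ j′ → cong (λ z → not z ∨ lookup Q j′) (∧-zeroʳ p))))
  later-row : ∀ k → allᵇ (λ j′ → not (lookup P k ∧ (toℕ j′ ≤ᵇ suc (toℕ k))) ∨ lookup (q ∷ Q) j′) (allFin (suc n))
                    ≡ (not (lookup P k) ∨ q) ∧ allᵇ (λ k′ → not (lookup P k ∧ (toℕ k′ ≤ᵇ toℕ k)) ∨ lookup Q k′) (allFin n)
  later-row k = trans (allᵇ-allFin-suc (λ j′ → not (lookup P k ∧ (toℕ j′ ≤ᵇ suc (toℕ k))) ∨ lookup (q ∷ Q) j′))
                      (cong₂ _∧_ (cong (λ z → not z ∨ q) (∧-identityʳ (lookup P k)))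
                                 (allᵇ-cong (allFin n) (λ k′ → cong (λ z → not (lookup P k ∧ z) ∨ lookup Q k′)
                                                                    (<ᵇ-suc (toℕ k′) (toℕ k)))))

emptyᵇ-isPrefixᵇ : ∀ {n} (P : Subset n) → emptyᵇ P ∧ isPrefixᵇ P ≡ emptyᵇ P
emptyᵇ-isPrefixᵇ []          = refl
emptyᵇ-isPrefixᵇ (true ∷ P)  = refl
emptyᵇ-isPrefixᵇ (false ∷ P) with emptyᵇ P
... | true  = refl
... | false = refl

downClosedᵇ-self : ∀ {n} (P : Subset n) → downClosedᵇ P P ≡ isPrefixᵇ P
downClosedᵇ-self []          = refl
downClosedᵇ-self (true ∷ P)
  rewrite downClosedᵇ-∷ true true P P | nonemptyImpliesᵇ-true P = downClosedᵇ-self P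
downClosedᵇ-self (false ∷ P) =
  trans (downClosedᵇ-∷ false false P P)
        (trans (cong₂ _∧_ (nonemptyImpliesᵇ-false P) (downClosedᵇ-self P)) (emptyᵇ-isPrefixᵇ P))

⊆ᵇ-empty : ∀ {n} (P Q : Subset n) → emptyᵇ Q ≡ true → (P ⊆ᵇ Q) ≡ emptyᵇ P
⊆ᵇ-empty []      []          _ = refl
⊆ᵇ-empty (p ∷ P) (false ∷ Q) Q-empty rewrite ⊆ᵇ-∷ p false P Q | ⊆ᵇ-empty P Q Q-empty with p
... | true  = refl
... | false = refl

isPrefixᵇ-tail : ∀ {n} p (P : Subset n) → isPrefixᵇ (p ∷ P) ≡ true → isPrefixᵇ P ≡ true
isPrefixᵇ-tail true  P prefixP = prefixP
isPrefixᵇ-tail false P prefixP = trans (cong (_∧ isPrefixᵇ P) (sym prefixP)) (trans (emptyᵇ-isPrefixᵇ P) prefixP)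

downClosedᵇ-prefixes : ∀ {n} (P Q : Subset n) → isPrefixᵇ P ≡ true → isPrefixᵇ Q ≡ true → downClosedᵇ P Q ≡ (P ⊆ᵇ Q)
downClosedᵇ-prefixes []      []          _       _ = refl
downClosedᵇ-prefixes (p ∷ P) (true ∷ Q)  prefixP prefixQ
  rewrite downClosedᵇ-∷ p true P Q | nonemptyImpliesᵇ-true P | ⊆ᵇ-∷ p true P Q
        | downClosedᵇ-prefixes P Q (isPrefixᵇ-tail p P prefixP) prefixQ = refl
downClosedᵇ-prefixes (p ∷ P) (false ∷ Q) prefixP prefixQ
  rewrite downClosedᵇ-∷ p false P Q | nonemptyImpliesᵇ-false P | ⊆ᵇ-∷ p false P Q
        | downClosedᵇ-prefixes P Q (isPrefixᵇ-tail p P prefixP) (isPrefixᵇ-tail false Q prefixQ)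
        | ⊆ᵇ-empty P Q prefixQ with emptyᵇ P
... | true  = refl
... | false rewrite ∧-zeroʳ (not p ∨ false) = refl

allᵇ-elts : ∀ {n} (p : Elt n → Bool) →
            allᵇ p (elts n) ≡ allᵇ (p ∘ (fzero ,_)) (allFin n) ∧ allᵇ (p ∘ (fsuc fzero ,_)) (allFin n)
allᵇ-elts {n} p =
  trans (allᵇ-++ p (map (fzero ,_) (allFin n)) (map (fsuc fzero ,_) (allFin n) ++ []))
        (cong₂ _∧_ (allᵇ-map p (fzero ,_) (allFin n))
                   (trans (allᵇ-++ p (map (fsuc fzero ,_) (allFin n)) [])
                          (trans (∧-identityʳ _) (allᵇ-map p (fsuc fzero ,_) (allFin n)))))

∑-elts : ∀ {n} (f : Elt n → ℕ) → ∑ (elts n) f ≡ ∑ (allFin n) (f ∘ (fzero ,_)) + ∑ (allFin n) (f ∘ (fsuc fzero ,_))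
∑-elts {n} f = trans (∑-cartesianProduct (allFin 2) (allFin n) f)
                     (cong (∑ (allFin n) (f ∘ (fzero ,_)) +_) (ℕ.+-identityʳ (∑ (allFin n) (f ∘ (fsuc fzero ,_)))))

isIdeal-downClosed : ∀ {n} (A B : Subset n) → isIdeal (A , B) ≡ downClosedᵇ A A ∧ (downClosedᵇ B A ∧ downClosedᵇ B B)
isIdeal-downClosed {n} A B =
  trans (allᵇ-elts (λ x → allᵇ (closed x) (elts n)))
        (cong₂ _∧_ (trans (allᵇ-cong (allFin n) (λ j → allᵇ-elts (closed (fzero , j))))
                          (trans (allᵇ-∧ _ _ (allFin n))
                                 (trans (cong (downClosedᵇ A A ∧_)
                                              (allᵇ-true (allFin n) (λ j → allᵇ-true (allFin n) (λ j′ →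
                                                cong (λ z → not z ∨ lookup B j′) (∧-zeroʳ (lookup A j))))))
                                        (∧-identityʳ _))))
                   (trans (allᵇ-cong (allFin n) (λ j → allᵇ-elts (closed (fsuc fzero , j))))
                          (allᵇ-∧ _ _ (allFin n))))
  where
  closed : Elt n → Elt n → Bool
  closed x y = not (memP (A , B) x ∧ leP y x) ∨ memP (A , B) y

isIdeal-prefixes : ∀ {n} (A B : Subset n) → isIdeal (A , B) ≡ (isPrefixᵇ A ∧ isPrefixᵇ B) ∧ (B ⊆ᵇ A)
isIdeal-prefixes A B rewrite isIdeal-downClosed A B | downClosedᵇ-self A | downClosedᵇ-self B
  with isPrefixᵇ A in prefixA | isPrefixᵇ B in prefixB
... | false | _     = refl
... | true  | false rewrite ∧-zeroʳ (downClosedᵇ B A) = refl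
... | true  | true  rewrite downClosedᵇ-prefixes B A prefixB prefixA | ∧-identityʳ (B ⊆ᵇ A) = refl

prefix-⊆ᵇ : ∀ n a b → a ≤ n → b ≤ n → (prefix n b ⊆ᵇ prefix n a) ≡ (b ≤ᵇ a)
prefix-⊆ᵇ zero    zero    zero    _         _         = refl
prefix-⊆ᵇ (suc n) zero    zero    _         _         = trans (⊆ᵇ-∷ false false (prefix n 0) (prefix n 0)) (prefix-⊆ᵇ n 0 0 z≤n z≤n)
prefix-⊆ᵇ (suc n) (suc a) zero    (s≤s a≤n) _         = trans (⊆ᵇ-∷ false true (prefix n 0) (prefix n a)) (prefix-⊆ᵇ n a 0 a≤n z≤n)
prefix-⊆ᵇ (suc n) zero    (suc b) _         _         = ⊆ᵇ-∷ true false (prefix n b) (prefix n 0)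
prefix-⊆ᵇ (suc n) (suc a) (suc b) (s≤s a≤n) (s≤s b≤n) =
  trans (⊆ᵇ-∷ true true (prefix n b) (prefix n a)) (trans (prefix-⊆ᵇ n a b a≤n b≤n) (sym (<ᵇ-suc b a)))

𝟙-∧₃ : ∀ x y z F → 𝟙 ((x ∧ y) ∧ z) * F ≡ 𝟙 x * (𝟙 y * (𝟙 z * F))
𝟙-∧₃ true  true  z F = sym (trans (ℕ.+-identityʳ _) (ℕ.+-identityʳ _))
𝟙-∧₃ true  false z F = refl
𝟙-∧₃ false y     z F = refl

∑-J : ∀ n (F : SubP n → ℕ) → ∑ (J n) F ≡ ∑staircase n (λ a b → F (prefix n a , prefix n b))
∑-J n F = begin
  ∑ (J n) F
    ≡⟨ ∑-filter isIdeal (allSubP n) F ⟩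
  ∑ (allSubP n) (λ X → 𝟙 (isIdeal X) * F X)
    ≡⟨ ∑-cartesianProduct (allSubsets n) (allSubsets n) (λ X → 𝟙 (isIdeal X) * F X) ⟩
  ∑ (allSubsets n) (λ A → ∑ (allSubsets n) (λ B → 𝟙 (isIdeal (A , B)) * F (A , B)))
    ≡⟨ ∑-cong (allSubsets n) (λ A →
         trans (∑-cong (allSubsets n) (λ B → trans (cong (λ z → 𝟙 z * F (A , B)) (isIdeal-prefixes A B))
                                                   (𝟙-∧₃ (isPrefixᵇ A) (isPrefixᵇ B) (B ⊆ᵇ A) (F (A , B)))))
               (∑-*ˡ (allSubsets n) (𝟙 (isPrefixᵇ A)) _)) ⟩
  ∑ (allSubsets n) (λ A → 𝟙 (isPrefixᵇ A) * ∑ (allSubsets n) (λ B → 𝟙 (isPrefixᵇ B) * (𝟙 (B ⊆ᵇ A) * F (A , B))))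
    ≡⟨ ∑-allSubsets-prefix n _ ⟩
  ∑ (upTo (suc n)) (λ a → ∑ (allSubsets n) (λ B → 𝟙 (isPrefixᵇ B) * (𝟙 (B ⊆ᵇ prefix n a) * F (prefix n a , B))))
    ≡⟨ ∑-cong (upTo (suc n)) (λ a → ∑-allSubsets-prefix n (λ B → 𝟙 (B ⊆ᵇ prefix n a) * F (prefix n a , B))) ⟩
  ∑ (upTo (suc n)) (λ a → ∑ (upTo (suc n)) (λ b → 𝟙 (prefix n b ⊆ᵇ prefix n a) * F (prefix n a , prefix n b)))
    ≡⟨ ∑-upTo-cong (suc n) (λ a a<1+n → ∑-upTo-cong (suc n) (λ b b<1+n →
         cong (λ z → 𝟙 z * F (prefix n a , prefix n b)) (prefix-⊆ᵇ n a b (ℕ.≤-pred a<1+n) (ℕ.≤-pred b<1+n)))) ⟩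
  ∑staircase n (λ a b → F (prefix n a , prefix n b)) ∎
  where open ≡-Reasoning

size-prefix : ∀ n a → a ≤ n → ∑ (allFin n) (λ j → 𝟙 (lookup (prefix n a) j)) ≡ a
size-prefix zero    zero    _         = refl
size-prefix (suc n) zero    _         = trans (∑-allFin-suc (λ j → 𝟙 (lookup (prefix (suc n) 0) j))) (size-prefix n 0 z≤n)
size-prefix (suc n) (suc a) (s≤s a≤n) =
  trans (∑-allFin-suc (λ j → 𝟙 (lookup (prefix (suc n) (suc a)) j))) (cong suc (size-prefix n a a≤n))

rankJ-prefixes : ∀ n a b → a ≤ n → b ≤ n → rankJ (prefix n a , prefix n b) ≡ a + b
rankJ-prefixes n a b a≤n b≤n =
  trans (length-filterᵇ (memP (prefix n a , prefix n b)) (elts n))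
        (trans (∑-elts (λ x → 𝟙 (memP (prefix n a , prefix n b) x))) (cong₂ _+_ (size-prefix n a a≤n) (size-prefix n b b≤n)))

⊆P-prefixes : ∀ n a b a′ b′ → a ≤ n → b ≤ n → a′ ≤ n → b′ ≤ n →
              ⊆P (prefix n a , prefix n b) (prefix n a′ , prefix n b′) ≡ (a ≤ᵇ a′) ∧ (b ≤ᵇ b′)
⊆P-prefixes n a b a′ b′ a≤n b≤n a′≤n b′≤n =
  trans (allᵇ-elts (λ x → not (memP (prefix n a , prefix n b) x) ∨ memP (prefix n a′ , prefix n b′) x))
        (cong₂ _∧_ (prefix-⊆ᵇ n a′ a a′≤n a≤n) (prefix-⊆ᵇ n b′ b b′≤n b≤n))

⊂P-prefixes : ∀ n a b a′ b′ → a ≤ n → b ≤ n → a′ ≤ n → b′ ≤ n →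
              ⊂P (prefix n a , prefix n b) (prefix n a′ , prefix n b′) ≡ strictlyBelow a b a′ b′
⊂P-prefixes n a b a′ b′ a≤n b≤n a′≤n b′≤n =
  cong₂ (λ below above → below ∧ not above) (⊆P-prefixes n a b a′ b′ a≤n b≤n a′≤n b′≤n) (⊆P-prefixes n a′ b′ a b a′≤n b′≤n a≤n b≤n)

-- Chains of J(2 × n)

filterᵇ-cong : ∀ {A : Set} {p q : A → Bool} → (∀ x → p x ≡ q x) → (xs : List A) → filterᵇ p xs ≡ filterᵇ q xs
filterᵇ-cong p≡q []       = refl
filterᵇ-cong {p = p} {q} p≡q (x ∷ xs) rewrite p≡q x with q x
... | true  = cong (x ∷_) (filterᵇ-cong p≡q xs)
... | false = filterᵇ-cong p≡q xs

length-concatMap-∷ : ∀ {A : Set} (Z : A → List (List A)) (L : List A) →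
                     length (concatMap (λ x → map (x ∷_) (Z x)) L) ≡ ∑ L (length ∘ Z)
length-concatMap-∷ Z []      = refl
length-concatMap-∷ Z (x ∷ L) =
  trans (length-++ (map (x ∷_) (Z x))) (cong₂ _+_ (length-map (x ∷_) (Z x)) (length-concatMap-∷ Z L))

firstAbove : ∀ {n} → SubP n → List (SubP n) → Bool
firstAbove x []      = true
firstAbove x (y ∷ _) = ⊂P x y

chainsAbove : (n : ℕ) → SubP n → List ℕ → ℕ
chainsAbove n x ss = length (filterᵇ (firstAbove x) (chainsWithRanks n ss))

length-filterᵇ-map-∷ : ∀ {A : Set} (p : List A → Bool) (y : A) b (C : List (List A)) → (∀ l → p (y ∷ l) ≡ b) →
                       length (filterᵇ p (map (y ∷_) C)) ≡ 𝟙 b * length C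
length-filterᵇ-map-∷ p y b []      p≡b = sym (ℕ.*-zeroʳ (𝟙 b))
length-filterᵇ-map-∷ p y b (c ∷ C) p≡b rewrite p≡b c with b
... | true  = cong suc (length-filterᵇ-map-∷ p y true C p≡b)
... | false = length-filterᵇ-map-∷ p y false C p≡b

chainsWithRanks-∷ : ∀ n s ss → length (chainsWithRanks n (s ∷ ss)) ≡ ∑ (J n) (λ x → 𝟙 (rankJ x ≡ᵇ s) * chainsAbove n x ss)
chainsWithRanks-∷ n s ss =
  trans (length-concatMap-∷ _ (filterᵇ (λ x → rankJ x ≡ᵇ s) (J n)))
        (trans (∑-filter (λ x → rankJ x ≡ᵇ s) (J n) _)
               (∑-cong (J n) (λ x → cong (λ k → 𝟙 (rankJ x ≡ᵇ s) * length k)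
                                         (filterᵇ-cong (λ { [] → refl ; (y ∷ l) → refl }) (chainsWithRanks n ss)))))

-- chainsWithRanks filters with a where-bound copy of firstAbove, equal to it only pointwise.
length-filterᵇ-firstAbove : ∀ {n} (x : SubP n) (C : List (List (SubP n))) (r : SubP n → Bool)
  (above : SubP n → List (SubP n) → Bool) (L : List (SubP n)) → (∀ y l → above y l ≡ firstAbove y l) →
  length (filterᵇ (firstAbove x) (concatMap (λ y → map (y ∷_) (filterᵇ (above y) C)) (filterᵇ r L)))
  ≡ ∑ L (λ y → 𝟙 (r y) * (𝟙 (⊂P x y) * length (filterᵇ (firstAbove y) C)))
length-filterᵇ-firstAbove {n} x C r above L above≡ =
  trans (length-filterᵇ (firstAbove x) (concatMap extend (filterᵇ r L)))
        (trans (∑-concatMap extend (filterᵇ r L) (𝟙 ∘ firstAbove x))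
               (trans (∑-filter r L _)
                      (∑-cong L (λ y → cong (𝟙 (r y) *_)
                        (trans (sym (length-filterᵇ (firstAbove x) (extend y)))
                               (trans (length-filterᵇ-map-∷ (firstAbove x) y (⊂P x y) (filterᵇ (above y) C) (λ _ → refl))
                                      (cong (λ k → 𝟙 (⊂P x y) * length k) (filterᵇ-cong (above≡ y) C))))))))
  where
  extend : SubP n → List (List (SubP n))
  extend y = map (y ∷_) (filterᵇ (above y) C)

chainsAbove-∷ : ∀ n x s ss →
  chainsAbove n x (s ∷ ss) ≡ ∑ (J n) (λ y → 𝟙 (rankJ y ≡ᵇ s) * (𝟙 (⊂P x y) * chainsAbove n y ss))
chainsAbove-∷ n x s ss =
  length-filterᵇ-firstAbove x (chainsWithRanks n ss) (λ y → rankJ y ≡ᵇ s) _ (J n) λ { y [] → refl ; y (z ∷ l) → refl }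

positionsFrom : ℕ → List Bool → List ℕ
positionsFrom i []          = []
positionsFrom i (true ∷ T)  = i ∷ positionsFrom (suc i) T
positionsFrom i (false ∷ T) = positionsFrom (suc i) T

chainsAbove-prefixes : ∀ n T i a b → a ≤ n → b ≤ n →
  chainsAbove n (prefix n a , prefix n b) (positionsFrom i T) ≡ staircaseChains n a b i T
chainsAbove-prefixes n []          i a b a≤n b≤n = refl
chainsAbove-prefixes n (false ∷ T) i a b a≤n b≤n = chainsAbove-prefixes n T (suc i) a b a≤n b≤n
chainsAbove-prefixes n (true ∷ T)  i a b a≤n b≤n =
  trans (chainsAbove-∷ n (prefix n a , prefix n b) i (positionsFrom (suc i) T))
        (trans (∑-J n _)
               (∑staircase-cong n (λ a′ b′ a′≤n b′≤n →
                  cong₂ (λ r k → 𝟙 (r ≡ᵇ i) * k) (rankJ-prefixes n a′ b′ a′≤n b′≤n)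
                        (cong₂ (λ lt k → 𝟙 lt * k) (⊂P-prefixes n a b a′ b′ a≤n b≤n a′≤n b′≤n)
                               (chainsAbove-prefixes n T (suc i) a′ b′ a′≤n b′≤n)))))

chainsWithRanks-positionsFrom : ∀ n T i →
  length (chainsWithRanks n (positionsFrom (suc i) T)) ≡ staircaseChains n 0 0 (suc i) T
chainsWithRanks-positionsFrom n []          i = refl
chainsWithRanks-positionsFrom n (false ∷ T) i = chainsWithRanks-positionsFrom n T (suc i)
chainsWithRanks-positionsFrom n (true ∷ T)  i =
  trans (chainsWithRanks-∷ n (suc i) (positionsFrom (suc (suc i)) T))
        (trans (∑-J n _)
               (∑staircase-cong n (λ a′ b′ a′≤n b′≤n →
                  trans (cong₂ (λ r k → 𝟙 (r ≡ᵇ suc i) * k) (rankJ-prefixes n a′ b′ a′≤n b′≤n)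
                                                             (chainsAbove-prefixes n T (suc (suc i)) a′ b′ a′≤n b′≤n))
                        (sym (trans (strictlyBelow-higherRank 0 0 (suc i) H a′ b′ (s≤s z≤n))
                                    (cong (𝟙 (a′ + b′ ≡ᵇ suc i) *_) (ℕ.+-identityʳ _)))))))
  where
  H : ℕ → ℕ → ℕ
  H a′ b′ = staircaseChains n a′ b′ (suc (suc i)) T

members≡positionsFrom : ∀ {m} (S : Subset m) → members S ≡ positionsFrom 1 (Vec.toList S)
members≡positionsFrom S = go S (λ j → j) 1 (λ _ → refl) (λ _ → refl)
  where
  go : ∀ {A : Set} {m} (S : Subset m) (g : Fin m → A) {P : A → Bool} {f : A → ℕ} (i : ℕ) →
       (∀ j → P (g j) ≡ lookup S j) → (∀ j → f (g j) ≡ i + toℕ j) →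
       map f (filterᵇ P (List.tabulate g)) ≡ positionsFrom i (Vec.toList S)
  go []      g i P≡ f≡ = refl
  go (s ∷ S) g {P} i P≡ f≡ with P (g fzero) | P≡ fzero
  ... | true  | refl = cong₂ _∷_ (trans (f≡ fzero) (ℕ.+-identityʳ i))
                             (go S (g ∘ fsuc) (suc i) (P≡ ∘ fsuc) (λ j → trans (f≡ (fsuc j)) (ℕ.+-suc i (toℕ j))))
  ... | false | refl = go S (g ∘ fsuc) (suc i) (P≡ ∘ fsuc) (λ j → trans (f≡ (fsuc j)) (ℕ.+-suc i (toℕ j)))

alpha≡staircaseChains : ∀ n (S : Subset (2 * n ∸ 1)) → alpha n S ≡ staircaseChains n 0 0 1 (Vec.toList S)
alpha≡staircaseChains n S =
  trans (cong (length ∘ chainsWithRanks n) (members≡positionsFrom S)) (chainsWithRanks-positionsFrom n (Vec.toList S) 0)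

-- Long non-final sequences and descents

Des : (n : ℕ) → List Step → Subset (2 * n ∸ 1)
Des n w = tabulate (λ j → inDes w (suc (toℕ j)))

record FlagPattern (Q : Pattern) : Set where
  field
    window          : IsWindowPattern Q
    segmentsForced  : SegmentsForced Q
    -- A path starts as if it were preceded by an h-step.
    start-after-h   : ∀ y → Q nothing (just v) (just y) ≡ Q (just h) (just v) (just y)

longRun-flagPattern : FlagPattern isLS
longRun-flagPattern = record
  { window = longRun-window ; segmentsForced = longRun-segmentsForced ; start-after-h = λ { v → refl ; h → refl } }

descent-flagPattern : FlagPattern descent
descent-flagPattern = record
  { window = descent-window ; segmentsForced = descent-segmentsForced ; start-after-h = λ _ → refl }

module _ (n′ : ℕ) where

  private
    n : ℕ
    n = suc n′
    M : ℕ
    M = 2 * n ∸ 1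

  count-patternSet-⊆ : ∀ {Q} → FlagPattern Q → (g : List Step → ℕ → Bool) → (∀ x w j → g (x ∷ w) (suc j) ≡ occursAt Q nothing x w j) →
            ∀ T → ∑ (Dyck n) (λ w → 𝟙 (tabulate (g w ∘ suc ∘ toℕ) ⊆ᵇ T)) ≡ staircaseChains n 0 0 1 (Vec.toList T)
  count-patternSet-⊆ {Q} flag g g≡ T = begin
    ∑ (Dyck n) (λ w → 𝟙 (V w ⊆ᵇ T))
      ≡⟨ ∑-filter (dyckFrom 0) (allWords (suc M)) (λ w → 𝟙 (V w ⊆ᵇ T)) ⟩
    ∑ (allWords (suc M)) (λ w → 𝟙 (dyckFrom 0 w) * 𝟙 (V w ⊆ᵇ T))
      ≡⟨ ∑-allWords-suc M _ ⟩
    ∑ (allWords M) (λ w → 𝟙 (dyckFrom 1 w) * 𝟙 (V (v ∷ w) ⊆ᵇ T) + 0)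
      ≡⟨ ∑-cong (allWords M) (λ w → trans (ℕ.+-identityʳ _)
                                          (cong (λ b → 𝟙 (dyckFrom 1 w) * 𝟙 b) (⊆ᵇ-occursOnlyIn window (g (v ∷ w)) v w (g≡ v w) T))) ⟩
    ∑ (allWords M) (λ w → 𝟙 (dyckFrom 1 w) * 𝟙 (occursOnlyIn Q nothing v w T))
      ≡⟨ count-completions Q nothing v 1 1 0 refl T ⟩
    completions Q nothing v 1 0 (Vec.toList T)
      ≡⟨ start (Vec.toList T) ⟩
    completions Q nothing h 0 0 (true ∷ Vec.toList T)
      ≡⟨ completions≡staircaseChains segmentsForced n (segmented (Vec.toList T)) nothing h 0 0 z≤n z≤n
           (trans (cong suc (length-toList T)) (cong (n +_) (ℕ.+-identityʳ n))) ⟩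
    staircaseChains n 0 0 1 (Vec.toList T) ∎
    where
    open ≡-Reasoning
    open FlagPattern flag
    V : List Step → Subset M
    V w = tabulate (g w ∘ suc ∘ toℕ)
    -- A virtual h-step into the origin, at an allowed position, starts every path.
    start : ∀ L → completions Q nothing v 1 0 L ≡ completions Q nothing h 0 0 (true ∷ L)
    start L = trans (as-after-h L) (sym (trans (ℕ.+-identityʳ _) (trans (cong (_* completions Q (just h) v 1 0 L) allowed) (ℕ.*-identityˡ _))))
      where
      as-after-h : ∀ L → completions Q nothing v 1 0 L ≡ completions Q (just h) v 1 0 L
      as-after-h []      = refl
      as-after-h (t ∷ L) rewrite start-after-h v | start-after-h h = refl
      allowed : 𝟙 (not (Q nothing (just h) (just v)) ∨ true) ≡ 1
      allowed = cong 𝟙 (∨-zeroʳ (not (Q nothing (just h) (just v))))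

  alpha-LS : ∀ T → alpha n T ≡ ∑ (Dyck n) (λ w → 𝟙 (LS n w ⊆ᵇ T))
  alpha-LS T = trans (alpha≡staircaseChains n T) (sym (count-patternSet-⊆ longRun-flagPattern inLS inLS-occursAt T))

  alpha-Des : ∀ T → alpha n T ≡ ∑ (Dyck n) (λ w → 𝟙 (Des n w ⊆ᵇ T))
  alpha-Des T = trans (alpha≡staircaseChains n T) (sym (count-patternSet-⊆ descent-flagPattern inDes inDes-occursAt T))

  LS-Des-equidistributed : ∀ S → ∑ (Dyck n) (λ w → 𝟙 (LS n w ≡Sᵇ S)) ≡ ∑ (Dyck n) (λ w → 𝟙 (Des n w ≡Sᵇ S))
  LS-Des-equidistributed S =
    ℤ.+-injective (trans (sym (beta-inversion n (Dyck n) (LS n) alpha-LS S)) (beta-inversion n (Dyck n) (Des n) alpha-Des S))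

filterᵇ-map : ∀ {A B : Set} (p : B → Bool) (f : A → B) (xs : List A) → filterᵇ p (map f xs) ≡ map f (filterᵇ (p ∘ f) xs)
filterᵇ-map p f []       = refl
filterᵇ-map p f (x ∷ xs) with p (f x)
... | true  = cong (f x ∷_) (filterᵇ-map p f xs)
... | false = filterᵇ-map p f xs

filterᵇ-positions : ∀ n (g : ℕ → Bool) → filterᵇ g (positions n) ≡ members (tabulate (g ∘ suc ∘ toℕ))
filterᵇ-positions n g =
  trans (filterᵇ-map g (suc ∘ toℕ) (allFin (2 * n ∸ 1)))
        (cong (map (suc ∘ toℕ)) (filterᵇ-cong (λ j → sym (lookup∘tabulate (g ∘ suc ∘ toℕ) j)) (allFin (2 * n ∸ 1))))

hasSizeAndSumᵇ : ∀ {m} → ℕ → ℕ → Subset m → Bool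
hasSizeAndSumᵇ k s S = (length (members S) ≡ᵇ k) ∧ (sumℕ (members S) ≡ᵇ s)

count-hasSizeAndSum : ∀ (n k s : ℕ) (set : List Step → ℕ → Bool) →
  length (filterᵇ (λ w → (length (filterᵇ (set w) (positions n)) ≡ᵇ k) ∧ (sumℕ (filterᵇ (set w) (positions n)) ≡ᵇ s)) (Dyck n))
  ≡ ∑ (Dyck n) (λ w → 𝟙 (hasSizeAndSumᵇ k s (tabulate {n = 2 * n ∸ 1} (set w ∘ suc ∘ toℕ))))
count-hasSizeAndSum n k s set =
  trans (cong length (filterᵇ-cong (λ w → cong (λ P → (length P ≡ᵇ k) ∧ (sumℕ P ≡ᵇ s)) (filterᵇ-positions n (set w))) (Dyck n)))
        (length-filterᵇ (λ w → hasSizeAndSumᵇ k s (tabulate {n = 2 * n ∸ 1} (set w ∘ suc ∘ toℕ))) (Dyck n))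

open import Data.Integer using (+_)

corollary3p6 : (n : ℕ) → 1 ≤ n →
    ((S : Subset (2 * n ∸ 1)) → beta n S ≡ + countLS n S)
    × ((k m : ℕ) → LSq-coeff n k m ≡ Nq-coeff n k m)
corollary3p6 (suc n′) _ = flag-h-vector , q-Narayana
  where
  n : ℕ
  n = suc n′
  flag-h-vector : ∀ S → beta n S ≡ ℤ.+ countLS n S
  flag-h-vector S = trans (beta-inversion n (Dyck n) (LS n) (alpha-LS n′) S) (cong ℤ.+_ (sym (length-filterᵇ _ (Dyck n))))
  q-Narayana : ∀ k m → LSq-coeff n k m ≡ Nq-coeff n k m
  q-Narayana k m = begin
    LSq-coeff n k m
      ≡⟨ count-hasSizeAndSum n k m inLS ⟩
    ∑ (Dyck n) (λ w → 𝟙 (hasSizeAndSumᵇ k m (LS n w)))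
      ≡⟨ equidistributed-∑ _ (Dyck n) (LS n) (Des n) (LS-Des-equidistributed n′) (hasSizeAndSumᵇ k m) ⟩
    ∑ (Dyck n) (λ w → 𝟙 (hasSizeAndSumᵇ k m (Des n w)))
      ≡⟨ sym (count-hasSizeAndSum n k m inDes) ⟩
    Nq-coeff n k m ∎
    where open ≡-Reasoning
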